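{- Let $\mathcal{K}$ be a typed Kleene algebra. Then the biproduct completion $\mathrm{Mat}(\mathcal{K})$, with homsets ordered entrywise, is a Kleene bicategory.
   Context: A typed Kleene algebra is a category $\mathcal{K}$ whose homsets are join-semilattices with bottom ($+$, $0$), composition (diagrammatic, $;$) preserving finite joins in each argument, equipped with operations $(\cdot)^*\colon\mathcal{K}(A,A)\to\mathcal{K}(A,A)$ such that for all $f\colon A\to A$, $r\colon A\to B$, $l\colon B\to A$: $\mathrm{id}_A+f;f^*\le f^*$, $\mathrm{id}_A+f^*;f\le f^*$, $f;r\le r\Rightarrow f^*;r\le r$, $l;f\le l\Rightarrow l;f^*\le l$. $\mathrm{Mat}(\mathcal{K})$ has as objects finite formal sums $A_1\oplus\dots\oplus A_n$ of objects of $\mathcal{K}$; a morphism $A_1\oplus\dots\oplus A_n\to B_1\oplus\dots\oplus B_m$ is an $m\times n$ matrix $M$ with $M_{ji}\in\mathcal{K}(A_i,B_j)$; composition is matrix multiplication using $+$ as addition and composition of $\mathcal{K}$ as multiplication; identities are diagonal matrices with identities on the diagonal and $0$ elsewhere; $\oplus$ is concatenation of formal sums and block sum of matrices, giving finite biproducts. A Kleene bicategory is a poset-enriched symmetric monoidal category $(\mathcal{C},\oplus,0)$ with finite biproducts (monoids $(\nabla_X,¡_X)$, comonoids $(\Delta_X,!_X)$, all morphisms being homomorphisms) such that $\mathrm{id}_{X\oplus X}\le\nabla_X;\Delta_X$, $\Delta_X;\nabla_X\le\mathrm{id}_X$, $\mathrm{id}_0\le¡_X;!_X$, $!_X;¡_X\le\mathrm{id}_X$,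 together with a trace $\mathsf{tr}_S\colon\mathcal{C}(S\oplus X,S\oplus Y)\to\mathcal{C}(X,Y)$ (tightening, strength, joining, vanishing, sliding, yanking) satisfying (AU1) if $f;(r\oplus\mathrm{id}_Y)\le(r\oplus\mathrm{id}_X);g$ for some $r\colon S\to T$ then $\mathsf{tr}_Sf\le\mathsf{tr}_Tg$; (AU2) if $(r\oplus\mathrm{id}_X);f\le g;(r\oplus\mathrm{id}_Y)$ for some $r\colon T\to S$ then $\mathsf{tr}_Sf\le\mathsf{tr}_Tg$; (AT1) $\mathsf{tr}_X(\nabla_X;\Delta_X)\le\mathrm{id}_X$. -}

module Defs where

open import Level using (Level; _⊔_) renaming (suc to lsuc)
open import Data.Nat using (ℕ; zero; suc) renaming (_+_ to _+ℕ_)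
open import Data.Fin using (Fin; zero; suc; splitAt; _≟_)
open import Data.Sum using (_⊎_; inj₁; inj₂; [_,_]′)
open import Function using (_∘_)
open import Relation.Binary.PropositionalEquality using (_≡_; refl)
open import Relation.Nullary using (yes; no)

-- Composition is written diagrammatically:  f ⨾ g  means "f then g".

record TypedKleeneAlgebra (o ℓ e : Level) : Set (lsuc (o ⊔ ℓ ⊔ e)) where
  infix  4 _≈_ _≤_
  infixl 6 _+_
  infixr 9 _⨾_
  infix 10 _*
  field
    Obj   : Set o
    Hom   : Obj → Obj → Set ℓ
    _≈_   : ∀ {A B} → Hom A B → Hom A B → Set e
    ≈-refl  : ∀ {A B} {f : Hom A B} → f ≈ f
    ≈-sym   : ∀ {A B} {f g : Hom A B} → f ≈ g → g ≈ f
    ≈-trans : ∀ {A B} {f g h : Hom A B} → f ≈ g → g ≈ h → f ≈ h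
    id    : ∀ {A} → Hom A A
    _⨾_   : ∀ {A B C} → Hom A B → Hom B C → Hom A C
    ⨾-cong : ∀ {A B C} {f f' : Hom A B} {g g' : Hom B C} →
             f ≈ f' → g ≈ g' → f ⨾ g ≈ f' ⨾ g'
    identityˡ : ∀ {A B} {f : Hom A B} → id ⨾ f ≈ f
    identityʳ : ∀ {A B} {f : Hom A B} → f ⨾ id ≈ f
    assoc     : ∀ {A B C D} {f : Hom A B} {g : Hom B C} {h : Hom C D} →
                (f ⨾ g) ⨾ h ≈ f ⨾ (g ⨾ h)
    _+_   : ∀ {A B} → Hom A B → Hom A B → Hom A B
    0#    : ∀ {A B} → Hom A B
    +-cong  : ∀ {A B} {f f' g g' : Hom A B} → f ≈ f' → g ≈ g' → f + g ≈ f' + g'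
    +-assoc : ∀ {A B} {f g h : Hom A B} → (f + g) + h ≈ f + (g + h)
    +-comm  : ∀ {A B} {f g : Hom A B} → f + g ≈ g + f
    +-idem  : ∀ {A B} {f : Hom A B} → f + f ≈ f
    +-identityˡ : ∀ {A B} {f : Hom A B} → 0# + f ≈ f
    ⨾-distribˡ : ∀ {A B C} {f : Hom A B} {g h : Hom B C} → f ⨾ (g + h) ≈ f ⨾ g + f ⨾ h
    ⨾-distribʳ : ∀ {A B C} {f g : Hom A B} {h : Hom B C} → (f + g) ⨾ h ≈ f ⨾ h + g ⨾ h
    ⨾-zeroʳ    : ∀ {A B C} {f : Hom A B} → f ⨾ 0# {B} {C} ≈ 0#
    ⨾-zeroˡ    : ∀ {A B C} {f : Hom B C} → 0# {A} {B} ⨾ f ≈ 0#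
    _*    : ∀ {A} → Hom A A → Hom A A

  _≤_ : ∀ {A B} → Hom A B → Hom A B → Set e
  f ≤ g = f + g ≈ g

  field
    *-unfoldˡ   : ∀ {A} {f : Hom A A} → id + f ⨾ f * ≤ f *
    *-unfoldʳ   : ∀ {A} {f : Hom A A} → id + f * ⨾ f ≤ f *
    *-inductionˡ : ∀ {A B} {f : Hom A A} {r : Hom A B} → f ⨾ r ≤ r → f * ⨾ r ≤ r
    *-inductionʳ : ∀ {A B} {f : Hom A A} {l : Hom B A} → l ⨾ f ≤ l → l ⨾ f * ≤ l

-- Data of a poset-enriched category with a chosen tensor ⊕ and unit 𝟘
-- (the structure maps and all laws are in IsKleeneBicategory below).

record PosetTensorData (o ℓ e : Level) : Set (lsuc (o ⊔ ℓ ⊔ e)) where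
  infix  4 _≈_ _≤_
  infixr 9 _⨾_
  infixr 7 _⊕₁_
  infixr 7 _⊕₀_
  field
    Obj : Set o
    Hom : Obj → Obj → Set ℓ
    _≈_ : ∀ {A B} → Hom A B → Hom A B → Set e
    _≤_ : ∀ {A B} → Hom A B → Hom A B → Set e
    id  : (A : Obj) → Hom A A
    _⨾_ : ∀ {A B C} → Hom A B → Hom B C → Hom A C
    _⊕₀_ : Obj → Obj → Obj
    _⊕₁_ : ∀ {A B C D} → Hom A B → Hom C D → Hom (A ⊕₀ C) (B ⊕₀ D)
    𝟘   : Obj

record IsKleeneBicategory {o ℓ e} (C : PosetTensorData o ℓ e) : Set (o ⊔ ℓ ⊔ e) where
  open PosetTensorData C
  field
    ≈-refl   : ∀ {A B} {f : Hom A B} → f ≈ f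
    ≈-sym    : ∀ {A B} {f g : Hom A B} → f ≈ g → g ≈ f
    ≈-trans  : ∀ {A B} {f g h : Hom A B} → f ≈ g → g ≈ h → f ≈ h
    ≤-reflexive : ∀ {A B} {f g : Hom A B} → f ≈ g → f ≤ g
    ≤-trans  : ∀ {A B} {f g h : Hom A B} → f ≤ g → g ≤ h → f ≤ h
    ≤-antisym : ∀ {A B} {f g : Hom A B} → f ≤ g → g ≤ f → f ≈ g
    ⨾-mono   : ∀ {A B C} {f f' : Hom A B} {g g' : Hom B C} →
               f ≤ f' → g ≤ g' → f ⨾ g ≤ f' ⨾ g'
    identityˡ : ∀ {A B} {f : Hom A B} → id A ⨾ f ≈ f
    identityʳ : ∀ {A B} {f : Hom A B} → f ⨾ id B ≈ f
    assoc     : ∀ {A B C D} {f : Hom A B} {g : Hom B C} {h : Hom C D} →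
                (f ⨾ g) ⨾ h ≈ f ⨾ (g ⨾ h)
    ⊕-mono : ∀ {A B C D} {f f' : Hom A B} {g g' : Hom C D} →
             f ≤ f' → g ≤ g' → f ⊕₁ g ≤ f' ⊕₁ g'
    ⊕-id   : ∀ {A B} → id A ⊕₁ id B ≈ id (A ⊕₀ B)
    ⊕-⨾    : ∀ {A B C D E F} {f : Hom A B} {g : Hom B C} {h : Hom D E} {k : Hom E F} →
             (f ⨾ g) ⊕₁ (h ⨾ k) ≈ (f ⊕₁ h) ⨾ (g ⊕₁ k)
    α    : (A B C : Obj) → Hom ((A ⊕₀ B) ⊕₀ C) (A ⊕₀ (B ⊕₀ C))
    α⁻¹  : (A B C : Obj) → Hom (A ⊕₀ (B ⊕₀ C)) ((A ⊕₀ B) ⊕₀ C)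
    α-isoˡ : ∀ {A B C} → α A B C ⨾ α⁻¹ A B C ≈ id ((A ⊕₀ B) ⊕₀ C)
    α-isoʳ : ∀ {A B C} → α⁻¹ A B C ⨾ α A B C ≈ id (A ⊕₀ (B ⊕₀ C))
    α-natural : ∀ {A A' B B' C C'} {f : Hom A A'} {g : Hom B B'} {h : Hom C C'} →
                ((f ⊕₁ g) ⊕₁ h) ⨾ α A' B' C' ≈ α A B C ⨾ (f ⊕₁ (g ⊕₁ h))
    lu   : (A : Obj) → Hom (𝟘 ⊕₀ A) A
    lu⁻¹ : (A : Obj) → Hom A (𝟘 ⊕₀ A)
    lu-isoˡ : ∀ {A} → lu A ⨾ lu⁻¹ A ≈ id (𝟘 ⊕₀ A)
    lu-isoʳ : ∀ {A} → lu⁻¹ A ⨾ lu A ≈ id A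
    lu-natural : ∀ {A B} {f : Hom A B} → (id 𝟘 ⊕₁ f) ⨾ lu B ≈ lu A ⨾ f
    ru   : (A : Obj) → Hom (A ⊕₀ 𝟘) A
    ru⁻¹ : (A : Obj) → Hom A (A ⊕₀ 𝟘)
    ru-isoˡ : ∀ {A} → ru A ⨾ ru⁻¹ A ≈ id (A ⊕₀ 𝟘)
    ru-isoʳ : ∀ {A} → ru⁻¹ A ⨾ ru A ≈ id A
    ru-natural : ∀ {A B} {f : Hom A B} → (f ⊕₁ id 𝟘) ⨾ ru B ≈ ru A ⨾ f
    σ    : (A B : Obj) → Hom (A ⊕₀ B) (B ⊕₀ A)
    σ-natural : ∀ {A A' B B'} {f : Hom A A'} {g : Hom B B'} →
                (f ⊕₁ g) ⨾ σ A' B' ≈ σ A B ⨾ (g ⊕₁ f)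
    σ-involutive : ∀ {A B} → σ A B ⨾ σ B A ≈ id (A ⊕₀ B)
    pentagon : ∀ {A B C D} →
      (α A B C ⊕₁ id D) ⨾ α A (B ⊕₀ C) D ⨾ (id A ⊕₁ α B C D)
        ≈ α (A ⊕₀ B) C D ⨾ α A B (C ⊕₀ D)
    triangle : ∀ {A B} → α A 𝟘 B ⨾ (id A ⊕₁ lu B) ≈ ru A ⊕₁ id B
    hexagon : ∀ {A B C} →
      α A B C ⨾ σ A (B ⊕₀ C) ⨾ α B C A
        ≈ (σ A B ⊕₁ id C) ⨾ α B A C ⨾ (id B ⊕₁ σ A C)

  interchange : (X Y : Obj) → Hom ((X ⊕₀ Y) ⊕₀ (X ⊕₀ Y)) ((X ⊕₀ X) ⊕₀ (Y ⊕₀ Y))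
  interchange X Y =
    α X Y (X ⊕₀ Y)
    ⨾ (id X ⊕₁ (α⁻¹ Y X Y ⨾ (σ Y X ⊕₁ id Y) ⨾ α X Y Y))
    ⨾ α⁻¹ X X (Y ⊕₀ Y)

  interchange' : (X Y : Obj) → Hom ((X ⊕₀ X) ⊕₀ (Y ⊕₀ Y)) ((X ⊕₀ Y) ⊕₀ (X ⊕₀ Y))
  interchange' X Y =
    α X X (Y ⊕₀ Y)
    ⨾ (id X ⊕₁ (α⁻¹ X Y Y ⨾ (σ X Y ⊕₁ id Y) ⨾ α Y X Y))
    ⨾ α⁻¹ X Y (X ⊕₀ Y)

  field
    -- finite biproducts: natural, coherent commutative monoids and comonoids
    ∇ : (X : Obj) → Hom (X ⊕₀ X) X
    ¡ : (X : Obj) → Hom 𝟘 X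
    Δ : (X : Obj) → Hom X (X ⊕₀ X)
    ! : (X : Obj) → Hom X 𝟘
    ∇-assoc : ∀ {X} → (∇ X ⊕₁ id X) ⨾ ∇ X ≈ α X X X ⨾ (id X ⊕₁ ∇ X) ⨾ ∇ X
    ∇-unitˡ : ∀ {X} → (¡ X ⊕₁ id X) ⨾ ∇ X ≈ lu X
    ∇-unitʳ : ∀ {X} → (id X ⊕₁ ¡ X) ⨾ ∇ X ≈ ru X
    ∇-comm  : ∀ {X} → σ X X ⨾ ∇ X ≈ ∇ X
    Δ-assoc : ∀ {X} → Δ X ⨾ (Δ X ⊕₁ id X) ⨾ α X X X ≈ Δ X ⨾ (id X ⊕₁ Δ X)
    Δ-unitˡ : ∀ {X} → Δ X ⨾ (! X ⊕₁ id X) ≈ lu⁻¹ X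
    Δ-unitʳ : ∀ {X} → Δ X ⨾ (id X ⊕₁ ! X) ≈ ru⁻¹ X
    Δ-comm  : ∀ {X} → Δ X ⨾ σ X X ≈ Δ X
    ∇-natural : ∀ {X Y} {f : Hom X Y} → ∇ X ⨾ f ≈ (f ⊕₁ f) ⨾ ∇ Y
    ¡-natural : ∀ {X Y} {f : Hom X Y} → ¡ X ⨾ f ≈ ¡ Y
    Δ-natural : ∀ {X Y} {f : Hom X Y} → f ⨾ Δ Y ≈ Δ X ⨾ (f ⊕₁ f)
    !-natural : ∀ {X Y} {f : Hom X Y} → f ⨾ ! Y ≈ ! X
    ∇-⊕ : ∀ {X Y} → ∇ (X ⊕₀ Y) ≈ interchange X Y ⨾ (∇ X ⊕₁ ∇ Y)
    ¡-⊕ : ∀ {X Y} → ¡ (X ⊕₀ Y) ≈ lu⁻¹ 𝟘 ⨾ (¡ X ⊕₁ ¡ Y)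
    Δ-⊕ : ∀ {X Y} → Δ (X ⊕₀ Y) ≈ (Δ X ⊕₁ Δ Y) ⨾ interchange' X Y
    !-⊕ : ∀ {X Y} → ! (X ⊕₀ Y) ≈ (! X ⊕₁ ! Y) ⨾ lu 𝟘
    ∇-𝟘 : ∇ 𝟘 ≈ lu 𝟘
    ¡-𝟘 : ¡ 𝟘 ≈ id 𝟘
    Δ-𝟘 : Δ 𝟘 ≈ lu⁻¹ 𝟘
    !-𝟘 : ! 𝟘 ≈ id 𝟘
    ∇Δ-≥-id : ∀ {X} → id (X ⊕₀ X) ≤ ∇ X ⨾ Δ X
    Δ∇-≤-id : ∀ {X} → Δ X ⨾ ∇ X ≤ id X
    ¡!-≥-id : ∀ {X} → id 𝟘 ≤ ¡ X ⨾ ! X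
    !¡-≤-id : ∀ {X} → ! X ⨾ ¡ X ≤ id X
    tr : (S X Y : Obj) → Hom (S ⊕₀ X) (S ⊕₀ Y) → Hom X Y
    tightening : ∀ {S X X' Y Y'} (f : Hom X' X) (h : Hom (S ⊕₀ X) (S ⊕₀ Y)) (g : Hom Y Y') →
      tr S X' Y' ((id S ⊕₁ f) ⨾ h ⨾ (id S ⊕₁ g)) ≈ f ⨾ tr S X Y h ⨾ g
    strength : ∀ {S X Y Z W} (f : Hom (S ⊕₀ X) (S ⊕₀ Y)) (g : Hom Z W) →
      tr S (X ⊕₀ Z) (Y ⊕₀ W) (α⁻¹ S X Z ⨾ (f ⊕₁ g) ⨾ α S Y W) ≈ tr S X Y f ⊕₁ g
    joining : ∀ {S T X Y} (f : Hom ((S ⊕₀ T) ⊕₀ X) ((S ⊕₀ T) ⊕₀ Y)) →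
      tr (S ⊕₀ T) X Y f ≈ tr T X Y (tr S (T ⊕₀ X) (T ⊕₀ Y) (α⁻¹ S T X ⨾ f ⨾ α S T Y))
    vanishing : ∀ {X Y} (f : Hom (𝟘 ⊕₀ X) (𝟘 ⊕₀ Y)) →
      tr 𝟘 X Y f ≈ lu⁻¹ X ⨾ f ⨾ lu Y
    sliding : ∀ {S T X Y} (f : Hom (S ⊕₀ X) (T ⊕₀ Y)) (g : Hom T S) →
      tr S X Y (f ⨾ (g ⊕₁ id Y)) ≈ tr T X Y ((g ⊕₁ id X) ⨾ f)
    yanking : ∀ {X} → tr X X X (σ X X) ≈ id X
    AU1 : ∀ {S T X Y} (f : Hom (S ⊕₀ X) (S ⊕₀ Y)) (g : Hom (T ⊕₀ X) (T ⊕₀ Y)) (r : Hom S T) →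
      f ⨾ (r ⊕₁ id Y) ≤ (r ⊕₁ id X) ⨾ g → tr S X Y f ≤ tr T X Y g
    AU2 : ∀ {S T X Y} (f : Hom (S ⊕₀ X) (S ⊕₀ Y)) (g : Hom (T ⊕₀ X) (T ⊕₀ Y)) (r : Hom T S) →
      (r ⊕₁ id X) ⨾ f ≤ g ⨾ (r ⊕₁ id Y) → tr S X Y f ≤ tr T X Y g
    AT1 : ∀ {X} → tr X X X (∇ X ⨾ Δ X) ≤ id X

module MatConstruction {o ℓ e} (K : TypedKleeneAlgebra o ℓ e) where
  open TypedKleeneAlgebra K

  -- finite formal sums A₁ ⊕ ... ⊕ Aₙ
  record MObj : Set o where
    constructor mobj
    field
      size : ℕ
      at   : Fin size → Obj
  open MObj public

  -- an m×n matrix with (j,i)-entry in K(Aᵢ, Bⱼ)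
  MHom : MObj → MObj → Set ℓ
  MHom A B = (j : Fin (size B)) (i : Fin (size A)) → Hom (at A i) (at B j)

  sumFin : ∀ {X Y} (n : ℕ) → (Fin n → Hom X Y) → Hom X Y
  sumFin zero    f = 0#
  sumFin (suc n) f = f zero + sumFin n (f ∘ suc)

  _⨾M_ : ∀ {A B C} → MHom A B → MHom B C → MHom A C
  _⨾M_ {B = B} M N k i = sumFin (size B) (λ j → M j i ⨾ N k j)

  idM : (A : MObj) → MHom A A
  idM A j i with i ≟ j
  ... | yes refl = id
  ... | no _     = 0#

  _≈M_ : ∀ {A B} → MHom A B → MHom A B → Set e
  M ≈M N = ∀ j i → M j i ≈ N j i

  _≤M_ : ∀ {A B} → MHom A B → MHom A B → Set e
  M ≤M N = ∀ j i → M j i ≤ N j i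

  _⊕O_ : MObj → MObj → MObj
  A ⊕O B = mobj (size A +ℕ size B) ([ at A , at B ]′ ∘ splitAt (size A))

  blk : ∀ {A B C D} → MHom A B → MHom C D →
        (y : Fin (size B) ⊎ Fin (size D)) (x : Fin (size A) ⊎ Fin (size C)) →
        Hom ([ at A , at C ]′ x) ([ at B , at D ]′ y)
  blk M N (inj₁ j) (inj₁ i) = M j i
  blk M N (inj₂ j) (inj₂ i) = N j i
  blk M N (inj₁ j) (inj₂ i) = 0#
  blk M N (inj₂ j) (inj₁ i) = 0#

  _⊕M_ : ∀ {A B C D} → MHom A B → MHom C D → MHom (A ⊕O C) (B ⊕O D)
  _⊕M_ {A} {B} M N j i = blk M N (splitAt (size B) j) (splitAt (size A) i)

  𝟘M : MObj
  𝟘M = mobj 0 (λ ())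

  Mat : PosetTensorData o ℓ e
  Mat = record
    { Obj = MObj ; Hom = MHom ; _≈_ = _≈M_ ; _≤_ = _≤M_
    ; id = idM ; _⨾_ = _⨾M_ ; _⊕₀_ = _⊕O_ ; _⊕₁_ = _⊕M_ ; 𝟘 = 𝟘M }

open MatConstruction public using (Mat)

{-# OPTIONS --safe #-}
-- Mat(K) has biproducts (concatenation of formal sums, with the empty sum as zero object) and
-- its homsets are join-semilattices.  Stars of square matrices are built by induction on the
-- size: a 1×1 matrix uses the star of K, and a larger one is split into a 2×2 block matrix
-- (first summand, rest) whose star is given by Conway's formula.  Any semilattice-enriched
-- category with biproducts and such stars is a Kleene bicategory: the symmetric monoidal
-- structure and the (co)monoids are made of injections and projections, and the trace of
-- f : S ⊕ X → S ⊕ Y with components a, b, c, d is d + b a* c.  The trace axioms then reduce to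
-- laws of the star: uniformity to the simulation rules, sliding to g (a g)* = (g a)* g,
-- yanking to 0* = id, AT1 to id* ≤ id, and joining to Conway's formula.
module Submission where

open import Defs
open import Level using (Level; _⊔_) renaming (suc to lsuc)
open import Data.Nat using (ℕ; zero; suc) renaming (_+_ to _+ℕ_)
open import Data.Fin using (Fin; zero; suc; splitAt; _≟_)
open import Data.Fin.Properties using (+↔⊎; suc-injective)
open import Data.Sum using (_⊎_; inj₁; inj₂; [_,_]′; map₁)
open import Data.Product using (_,_)
open import Data.Empty using (⊥-elim)
open import Function using (_∘_)
open import Function.Bundles using (Injection)
open import Function.Properties.Inverse using (↔⇒↣)
open import Relation.Binary.PropositionalEquality using (_≡_; _≢_; refl; sym; cong)
open import Relation.Nullary using (yes; no)
open import Relation.Binary.Bundles using (Setoid; Poset)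
import Relation.Binary.Reasoning.Setoid as SetoidReasoning
import Relation.Binary.Reasoning.PartialOrder as PosetReasoning
open import Algebra.Bundles using (CommutativeMonoid)
import Algebra.Solver.CommutativeMonoid as CommutativeMonoidSolver

record TypedIdempotentSemiring (o ℓ e : Level) : Set (lsuc (o ⊔ ℓ ⊔ e)) where
  infix  4 _≈_ _≤_
  infixl 6 _+_
  infixr 9 _⨾_
  field
    Obj   : Set o
    Hom   : Obj → Obj → Set ℓ
    _≈_   : ∀ {A B} → Hom A B → Hom A B → Set e
    ≈-refl  : ∀ {A B} {f : Hom A B} → f ≈ f
    ≈-sym   : ∀ {A B} {f g : Hom A B} → f ≈ g → g ≈ f
    ≈-trans : ∀ {A B} {f g h : Hom A B} → f ≈ g → g ≈ h → f ≈ h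
    id    : ∀ {A} → Hom A A
    _⨾_   : ∀ {A B C} → Hom A B → Hom B C → Hom A C
    ⨾-cong : ∀ {A B C} {f f′ : Hom A B} {g g′ : Hom B C} →
             f ≈ f′ → g ≈ g′ → f ⨾ g ≈ f′ ⨾ g′
    identityˡ : ∀ {A B} {f : Hom A B} → id ⨾ f ≈ f
    identityʳ : ∀ {A B} {f : Hom A B} → f ⨾ id ≈ f
    assoc     : ∀ {A B C D} {f : Hom A B} {g : Hom B C} {h : Hom C D} →
                (f ⨾ g) ⨾ h ≈ f ⨾ (g ⨾ h)
    _+_   : ∀ {A B} → Hom A B → Hom A B → Hom A B
    0#    : ∀ {A B} → Hom A B
    +-cong  : ∀ {A B} {f f′ g g′ : Hom A B} → f ≈ f′ → g ≈ g′ → f + g ≈ f′ + g′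
    +-assoc : ∀ {A B} {f g h : Hom A B} → (f + g) + h ≈ f + (g + h)
    +-comm  : ∀ {A B} {f g : Hom A B} → f + g ≈ g + f
    +-idem  : ∀ {A B} {f : Hom A B} → f + f ≈ f
    +-identityˡ : ∀ {A B} {f : Hom A B} → 0# + f ≈ f
    ⨾-distribˡ : ∀ {A B C} {f : Hom A B} {g h : Hom B C} → f ⨾ (g + h) ≈ f ⨾ g + f ⨾ h
    ⨾-distribʳ : ∀ {A B C} {f g : Hom A B} {h : Hom B C} → (f + g) ⨾ h ≈ f ⨾ h + g ⨾ h
    ⨾-zeroʳ    : ∀ {A B C} {f : Hom A B} → f ⨾ 0# {B} {C} ≈ 0#
    ⨾-zeroˡ    : ∀ {A B C} {f : Hom B C} → 0# {A} {B} ⨾ f ≈ 0#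

  _≤_ : ∀ {A B} → Hom A B → Hom A B → Set e
  f ≤ g = f + g ≈ g

module IdempotentSemiringProperties {o ℓ e} (R : TypedIdempotentSemiring o ℓ e) where
  open TypedIdempotentSemiring R public

  private variable
    A B C D : Obj

  ≤-reflexive : {f g : Hom A B} → f ≈ g → f ≤ g
  ≤-reflexive f≈g = ≈-trans (+-cong f≈g ≈-refl) +-idem

  ≤-refl : {f : Hom A B} → f ≤ f
  ≤-refl = +-idem

  ≤-trans : {f g h : Hom A B} → f ≤ g → g ≤ h → f ≤ h
  ≤-trans f≤g g≤h = ≈-trans (+-cong ≈-refl (≈-sym g≤h))
    (≈-trans (≈-sym +-assoc) (≈-trans (+-cong f≤g ≈-refl) g≤h))

  ≤-antisym : {f g : Hom A B} → f ≤ g → g ≤ f → f ≈ g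
  ≤-antisym f≤g g≤f = ≈-trans (≈-sym g≤f) (≈-trans +-comm f≤g)

  homSetoid : Obj → Obj → Setoid ℓ e
  homSetoid A B = record
    { Carrier = Hom A B ; _≈_ = _≈_
    ; isEquivalence = record { refl = ≈-refl ; sym = ≈-sym ; trans = ≈-trans } }

  homPoset : Obj → Obj → Poset ℓ e e
  homPoset A B = record
    { Carrier = Hom A B ; _≈_ = _≈_ ; _≤_ = _≤_
    ; isPartialOrder = record
      { isPreorder = record
        { isEquivalence = Setoid.isEquivalence (homSetoid A B)
        ; reflexive = ≤-reflexive ; trans = ≤-trans }
      ; antisym = ≤-antisym } }

  +-commutativeMonoid : Obj → Obj → CommutativeMonoid ℓ e
  +-commutativeMonoid A B = record
    { Carrier = Hom A B ; _≈_ = _≈_ ; _∙_ = _+_ ; ε = 0#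
    ; isCommutativeMonoid = record
      { isMonoid = record
        { isSemigroup = record
          { isMagma = record
            { isEquivalence = Setoid.isEquivalence (homSetoid A B) ; ∙-cong = +-cong }
          ; assoc = λ _ _ _ → +-assoc }
        ; identity = (λ _ → +-identityˡ) , (λ _ → ≈-trans +-comm +-identityˡ) }
      ; comm = λ _ _ → +-comm } }

  module ≈-Reasoning {A B : Obj} = SetoidReasoning (homSetoid A B)
  module ≤-Reasoning {A B : Obj} = PosetReasoning (homPoset A B)

  ≈-≤-trans : {f g h : Hom A B} → f ≈ g → g ≤ h → f ≤ h
  ≈-≤-trans f≈g g≤h = ≤-trans (≤-reflexive f≈g) g≤h

  ≤-≈-trans : {f g h : Hom A B} → f ≤ g → g ≈ h → f ≤ h
  ≤-≈-trans f≤g g≈h = ≤-trans f≤g (≤-reflexive g≈h)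

  +-congˡ : {f f′ g : Hom A B} → f ≈ f′ → f + g ≈ f′ + g
  +-congˡ p = +-cong p ≈-refl

  +-congʳ : {f g g′ : Hom A B} → g ≈ g′ → f + g ≈ f + g′
  +-congʳ p = +-cong ≈-refl p

  ⨾-congˡ : {f f′ : Hom A B} {g : Hom B C} → f ≈ f′ → f ⨾ g ≈ f′ ⨾ g
  ⨾-congˡ p = ⨾-cong p ≈-refl

  ⨾-congʳ : {f : Hom A B} {g g′ : Hom B C} → g ≈ g′ → f ⨾ g ≈ f ⨾ g′
  ⨾-congʳ p = ⨾-cong ≈-refl p

  sym-assoc : {f : Hom A B} {g : Hom B C} {h : Hom C D} → f ⨾ (g ⨾ h) ≈ (f ⨾ g) ⨾ h
  sym-assoc = ≈-sym assoc

  assoc² : ∀ {E} {f : Hom A B} {g : Hom B C} {h : Hom C D} {k : Hom D E} →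
           (f ⨾ g ⨾ h) ⨾ k ≈ f ⨾ g ⨾ h ⨾ k
  assoc² = ≈-trans assoc (⨾-congʳ assoc)

  assoc³ : ∀ {E F} {f : Hom A B} {g : Hom B C} {h : Hom C D} {k : Hom D E} {m : Hom E F} →
           (f ⨾ g ⨾ h ⨾ k) ⨾ m ≈ f ⨾ g ⨾ h ⨾ k ⨾ m
  assoc³ = ≈-trans assoc (⨾-congʳ assoc²)

  assoc⁴ : ∀ {E F G} {f : Hom A B} {g : Hom B C} {h : Hom C D} {k : Hom D E} {m : Hom E F}
           {n : Hom F G} →
           (f ⨾ g ⨾ h ⨾ k ⨾ m) ⨾ n ≈ f ⨾ g ⨾ h ⨾ k ⨾ m ⨾ n
  assoc⁴ = ≈-trans assoc (⨾-congʳ assoc³)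

  ⨾-distribˡ′ : {f : Hom A B} {g h k : Hom B C} → g ≈ h + k → f ⨾ g ≈ f ⨾ h + f ⨾ k
  ⨾-distribˡ′ g≈h+k = ≈-trans (⨾-congʳ g≈h+k) ⨾-distribˡ

  +-identityʳ : {f : Hom A B} → f + 0# ≈ f
  +-identityʳ = ≈-trans +-comm +-identityˡ

  +-interchange : {f g h k : Hom A B} → (f + g) + (h + k) ≈ (f + h) + (g + k)
  +-interchange {f = f} {g} {h} {k} = begin
    (f + g) + (h + k) ≈⟨ +-assoc ⟩
    f + (g + (h + k)) ≈⟨ +-congʳ +-assoc ⟨
    f + ((g + h) + k) ≈⟨ +-congʳ (+-congˡ +-comm) ⟩
    f + ((h + g) + k) ≈⟨ +-congʳ +-assoc ⟩
    f + (h + (g + k)) ≈⟨ +-assoc ⟨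
    (f + h) + (g + k) ∎
    where open ≈-Reasoning

  0#≤ : {f : Hom A B} → 0# ≤ f
  0#≤ = +-identityˡ

  f≤f+g : {f g : Hom A B} → f ≤ f + g
  f≤f+g = ≈-trans (≈-sym +-assoc) (+-congˡ +-idem)

  g≤f+g : {f g : Hom A B} → g ≤ f + g
  g≤f+g = ≤-≈-trans f≤f+g +-comm

  +-least : {f g h : Hom A B} → f ≤ h → g ≤ h → f + g ≤ h
  +-least f≤h g≤h = ≈-trans +-assoc (≈-trans (+-congʳ g≤h) f≤h)

  f≤g⇒f≤g+h : {f g h : Hom A B} → f ≤ g → f ≤ g + h
  f≤g⇒f≤g+h f≤g = ≤-trans f≤g f≤f+g

  f≤h⇒f≤g+h : {f g h : Hom A B} → f ≤ h → f ≤ g + h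
  f≤h⇒f≤g+h f≤h = ≤-trans f≤h g≤f+g

  f+g≤h⇒f≤h : {f g h : Hom A B} → f + g ≤ h → f ≤ h
  f+g≤h⇒f≤h = ≤-trans f≤f+g

  f+g≤h⇒g≤h : {f g h : Hom A B} → f + g ≤ h → g ≤ h
  f+g≤h⇒g≤h = ≤-trans g≤f+g

  +-mono : {f f′ g g′ : Hom A B} → f ≤ f′ → g ≤ g′ → f + g ≤ f′ + g′
  +-mono f≤f′ g≤g′ = +-least (f≤g⇒f≤g+h f≤f′) (f≤h⇒f≤g+h g≤g′)

  ⨾-monoˡ : {f g : Hom A B} {h : Hom B C} → f ≤ g → f ⨾ h ≤ g ⨾ h
  ⨾-monoˡ f≤g = ≈-trans (≈-sym ⨾-distribʳ) (⨾-congˡ f≤g)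

  ⨾-monoʳ : {f : Hom A B} {g h : Hom B C} → g ≤ h → f ⨾ g ≤ f ⨾ h
  ⨾-monoʳ g≤h = ≈-trans (≈-sym ⨾-distribˡ) (⨾-congʳ g≤h)

  ⨾-mono : {f f′ : Hom A B} {g g′ : Hom B C} → f ≤ f′ → g ≤ g′ → f ⨾ g ≤ f′ ⨾ g′
  ⨾-mono f≤f′ g≤g′ = ≤-trans (⨾-monoˡ f≤f′) (⨾-monoʳ g≤g′)

  f⨾g≤h⇒f⨾g⨾k≤h⨾k : {f : Hom A B} {g : Hom B C} {h : Hom A C} {k : Hom C D} →
                      f ⨾ g ≤ h → f ⨾ (g ⨾ k) ≤ h ⨾ k
  f⨾g≤h⇒f⨾g⨾k≤h⨾k p = ≈-≤-trans sym-assoc (⨾-monoˡ p)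

  id≤f⇒g≤f⨾g : {f : Hom A A} {g : Hom A B} → id ≤ f → g ≤ f ⨾ g
  id≤f⇒g≤f⨾g id≤f = ≈-≤-trans (≈-sym identityˡ) (⨾-monoˡ id≤f)

  id≤f⇒g≤g⨾f : {f : Hom B B} {g : Hom A B} → id ≤ f → g ≤ g ⨾ f
  id≤f⇒g≤g⨾f id≤f = ≈-≤-trans (≈-sym identityʳ) (⨾-monoʳ id≤f)

  record KleeneStar (A : Obj) : Set (o ⊔ ℓ ⊔ e) where
    field
      star : Hom A A → Hom A A
      *-unfoldˡ    : ∀ {f} → id + f ⨾ star f ≤ star f
      *-unfoldʳ    : ∀ {f} → id + star f ⨾ f ≤ star f
      *-inductionˡ : ∀ {B f} {r : Hom A B} → f ⨾ r ≤ r → star f ⨾ r ≤ r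
      *-inductionʳ : ∀ {B f} {l : Hom B A} → l ⨾ f ≤ l → l ⨾ star f ≤ l

    id≤f* : ∀ {f} → id ≤ star f
    id≤f* = f+g≤h⇒f≤h *-unfoldˡ

    f⨾f*≤f* : ∀ {f} → f ⨾ star f ≤ star f
    f⨾f*≤f* = f+g≤h⇒g≤h *-unfoldˡ

    f*⨾f≤f* : ∀ {f} → star f ⨾ f ≤ star f
    f*⨾f≤f* = f+g≤h⇒g≤h *-unfoldʳ

  open KleeneStar public using (star)

  module _ (SA : KleeneStar A) (SB : KleeneStar B) where
    private
      module SA = KleeneStar SA
      module SB = KleeneStar SB

    *-simulationˡ : {x : Hom A A} {y : Hom B B} {r : Hom A B} →
                    x ⨾ r ≤ r ⨾ y → star SA x ⨾ r ≤ r ⨾ star SB y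
    *-simulationˡ {x} {y} {r} xr≤ry = ≤-trans (⨾-monoʳ (id≤f⇒g≤g⨾f SB.id≤f*)) (SA.*-inductionˡ (begin
      x ⨾ (r ⨾ star SB y)   ≈⟨ sym-assoc ⟩
      (x ⨾ r) ⨾ star SB y   ≤⟨ ⨾-monoˡ xr≤ry ⟩
      (r ⨾ y) ⨾ star SB y   ≈⟨ assoc ⟩
      r ⨾ (y ⨾ star SB y)   ≤⟨ ⨾-monoʳ SB.f⨾f*≤f* ⟩
      r ⨾ star SB y         ∎))
      where open ≤-Reasoning

    *-simulationʳ : {x : Hom A A} {y : Hom B B} {r : Hom A B} →
                    r ⨾ y ≤ x ⨾ r → r ⨾ star SB y ≤ star SA x ⨾ r
    *-simulationʳ {x} {y} {r} ry≤xr = ≤-trans (⨾-monoˡ (id≤f⇒g≤f⨾g SA.id≤f*)) (SB.*-inductionʳ (begin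
      (star SA x ⨾ r) ⨾ y   ≈⟨ assoc ⟩
      star SA x ⨾ (r ⨾ y)   ≤⟨ ⨾-monoʳ ry≤xr ⟩
      star SA x ⨾ (x ⨾ r)   ≈⟨ sym-assoc ⟩
      (star SA x ⨾ x) ⨾ r   ≤⟨ ⨾-monoˡ SA.f*⨾f≤f* ⟩
      star SA x ⨾ r         ∎))
      where open ≤-Reasoning

  *-sliding : (SA : KleeneStar A) (SB : KleeneStar B) {g : Hom B A} {a : Hom A B} →
              g ⨾ star SA (a ⨾ g) ≈ star SB (g ⨾ a) ⨾ g
  *-sliding SA SB = ≤-antisym (*-simulationʳ SB SA (≤-reflexive sym-assoc))
                              (*-simulationˡ SB SA (≤-reflexive assoc))

  module _ (S : KleeneStar A) where
    private module S = KleeneStar S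

    *-mono : {x y : Hom A A} → x ≤ y → star S x ≤ star S y
    *-mono x≤y = ≈-≤-trans (≈-sym identityʳ) (≤-≈-trans
      (*-simulationˡ S S (≈-≤-trans identityʳ (≤-≈-trans x≤y (≈-sym identityˡ)))) identityˡ)

    0*≈id : star S 0# ≈ id
    0*≈id = ≤-antisym
      (≈-≤-trans (≈-sym identityʳ) (S.*-inductionˡ (≈-≤-trans ⨾-zeroˡ 0#≤)))
      S.id≤f*

  *-unique : (S T : KleeneStar A) {f : Hom A A} → star S f ≈ star T f
  *-unique S T = ≤-antisym (least S T) (least T S)
    where
    least : (S T : KleeneStar A) {f : Hom A A} → star S f ≤ star T f
    least S T = ≤-trans (id≤f⇒g≤g⨾f (KleeneStar.id≤f* T))
                        (KleeneStar.*-inductionˡ S (KleeneStar.f⨾f*≤f* T))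

  record Biproduct (A B C : Obj) : Set (ℓ ⊔ e) where
    field
      ι₁ : Hom A C
      ι₂ : Hom B C
      π₁ : Hom C A
      π₂ : Hom C B
      ι₁⨾π₁≈id : ι₁ ⨾ π₁ ≈ id
      ι₂⨾π₂≈id : ι₂ ⨾ π₂ ≈ id
      ι₁⨾π₂≈0# : ι₁ ⨾ π₂ ≈ 0#
      ι₂⨾π₁≈0# : ι₂ ⨾ π₁ ≈ 0#
      π₁⨾ι₁+π₂⨾ι₂≈id : π₁ ⨾ ι₁ + π₂ ⨾ ι₂ ≈ id

  record HasBiproducts : Set (o ⊔ ℓ ⊔ e) where
    infixr 7 _⊕₀_ _⊕₁_
    field
      _⊕₀_ : Obj → Obj → Obj
      _⊕₁_ : ∀ {A B C D} → Hom A B → Hom C D → Hom (A ⊕₀ C) (B ⊕₀ D)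
      𝟘 : Obj
      biproduct : ∀ A B → Biproduct A B (A ⊕₀ B)
      ι₁⨾⊕ : ∀ {A B C D} {f : Hom A B} {g : Hom C D} →
             Biproduct.ι₁ (biproduct A C) ⨾ (f ⊕₁ g) ≈ f ⨾ Biproduct.ι₁ (biproduct B D)
      ι₂⨾⊕ : ∀ {A B C D} {f : Hom A B} {g : Hom C D} →
             Biproduct.ι₂ (biproduct A C) ⨾ (f ⊕₁ g) ≈ g ⨾ Biproduct.ι₂ (biproduct B D)
      𝟘-initial : ∀ {X} (f g : Hom 𝟘 X) → f ≈ g
      𝟘-terminal : ∀ {X} (f g : Hom X 𝟘) → f ≈ g

  module BiproductProperties {A B C} (bp : Biproduct A B C) where
    open Biproduct bp public

    private variable
      X Y : Obj

    [_,_] : Hom A Y → Hom B Y → Hom C Y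
    [ f , g ] = π₁ ⨾ f + π₂ ⨾ g

    ⟨_,_⟩ : Hom X A → Hom X B → Hom X C
    ⟨ f , g ⟩ = f ⨾ ι₁ + g ⨾ ι₂

    ι₁⨾π₁⨾ : {h : Hom A Y} → ι₁ ⨾ (π₁ ⨾ h) ≈ h
    ι₁⨾π₁⨾ = ≈-trans sym-assoc (≈-trans (⨾-congˡ ι₁⨾π₁≈id) identityˡ)

    ι₂⨾π₂⨾ : {h : Hom B Y} → ι₂ ⨾ (π₂ ⨾ h) ≈ h
    ι₂⨾π₂⨾ = ≈-trans sym-assoc (≈-trans (⨾-congˡ ι₂⨾π₂≈id) identityˡ)

    ι₁⨾π₂⨾ : {h : Hom B Y} → ι₁ ⨾ (π₂ ⨾ h) ≈ 0#
    ι₁⨾π₂⨾ = ≈-trans sym-assoc (≈-trans (⨾-congˡ ι₁⨾π₂≈0#) ⨾-zeroˡ)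

    ι₂⨾π₁⨾ : {h : Hom A Y} → ι₂ ⨾ (π₁ ⨾ h) ≈ 0#
    ι₂⨾π₁⨾ = ≈-trans sym-assoc (≈-trans (⨾-congˡ ι₂⨾π₁≈0#) ⨾-zeroˡ)

    ⨾ι₁⨾π₁ : {h : Hom X A} → (h ⨾ ι₁) ⨾ π₁ ≈ h
    ⨾ι₁⨾π₁ = ≈-trans assoc (≈-trans (⨾-congʳ ι₁⨾π₁≈id) identityʳ)

    ⨾ι₂⨾π₂ : {h : Hom X B} → (h ⨾ ι₂) ⨾ π₂ ≈ h
    ⨾ι₂⨾π₂ = ≈-trans assoc (≈-trans (⨾-congʳ ι₂⨾π₂≈id) identityʳ)

    ⨾ι₁⨾π₂ : {h : Hom X A} → (h ⨾ ι₁) ⨾ π₂ ≈ 0#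
    ⨾ι₁⨾π₂ = ≈-trans assoc (≈-trans (⨾-congʳ ι₁⨾π₂≈0#) ⨾-zeroʳ)

    ⨾ι₂⨾π₁ : {h : Hom X B} → (h ⨾ ι₂) ⨾ π₁ ≈ 0#
    ⨾ι₂⨾π₁ = ≈-trans assoc (≈-trans (⨾-congʳ ι₂⨾π₁≈0#) ⨾-zeroʳ)

    ι₁⨾[,] : {f : Hom A Y} {g : Hom B Y} → ι₁ ⨾ [ f , g ] ≈ f
    ι₁⨾[,] = ≈-trans ⨾-distribˡ (≈-trans (+-cong ι₁⨾π₁⨾ ι₁⨾π₂⨾) +-identityʳ)

    ι₂⨾[,] : {f : Hom A Y} {g : Hom B Y} → ι₂ ⨾ [ f , g ] ≈ g
    ι₂⨾[,] = ≈-trans ⨾-distribˡ (≈-trans (+-cong ι₂⨾π₁⨾ ι₂⨾π₂⨾) +-identityˡ)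

    ⟨,⟩⨾π₁ : {f : Hom X A} {g : Hom X B} → ⟨ f , g ⟩ ⨾ π₁ ≈ f
    ⟨,⟩⨾π₁ = ≈-trans ⨾-distribʳ (≈-trans (+-cong ⨾ι₁⨾π₁ ⨾ι₂⨾π₁) +-identityʳ)

    ⟨,⟩⨾π₂ : {f : Hom X A} {g : Hom X B} → ⟨ f , g ⟩ ⨾ π₂ ≈ g
    ⟨,⟩⨾π₂ = ≈-trans ⨾-distribʳ (≈-trans (+-cong ⨾ι₁⨾π₂ ⨾ι₂⨾π₂) +-identityˡ)

    [,]-η : {h : Hom C Y} → h ≈ [ ι₁ ⨾ h , ι₂ ⨾ h ]
    [,]-η {h = h} = begin
      h                                   ≈⟨ identityˡ ⟨
      id ⨾ h                              ≈⟨ ⨾-congˡ π₁⨾ι₁+π₂⨾ι₂≈id ⟨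
      (π₁ ⨾ ι₁ + π₂ ⨾ ι₂) ⨾ h             ≈⟨ ⨾-distribʳ ⟩
      (π₁ ⨾ ι₁) ⨾ h + (π₂ ⨾ ι₂) ⨾ h       ≈⟨ +-cong assoc assoc ⟩
      [ ι₁ ⨾ h , ι₂ ⨾ h ]                 ∎
      where open ≈-Reasoning

    ⟨,⟩-η : {h : Hom X C} → h ≈ ⟨ h ⨾ π₁ , h ⨾ π₂ ⟩
    ⟨,⟩-η {h = h} = begin
      h                                   ≈⟨ identityʳ ⟨
      h ⨾ id                              ≈⟨ ⨾-congʳ π₁⨾ι₁+π₂⨾ι₂≈id ⟨
      h ⨾ (π₁ ⨾ ι₁ + π₂ ⨾ ι₂)             ≈⟨ ⨾-distribˡ ⟩
      h ⨾ (π₁ ⨾ ι₁) + h ⨾ (π₂ ⨾ ι₂)       ≈⟨ +-cong sym-assoc sym-assoc ⟩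
      ⟨ h ⨾ π₁ , h ⨾ π₂ ⟩                 ∎
      where open ≈-Reasoning

    [,]-mono : {f f′ : Hom A Y} {g g′ : Hom B Y} → f ≤ f′ → g ≤ g′ → [ f , g ] ≤ [ f′ , g′ ]
    [,]-mono f≤f′ g≤g′ = +-mono (⨾-monoʳ f≤f′) (⨾-monoʳ g≤g′)

    ⟨,⟩-mono : {f f′ : Hom X A} {g g′ : Hom X B} → f ≤ f′ → g ≤ g′ → ⟨ f , g ⟩ ≤ ⟨ f′ , g′ ⟩
    ⟨,⟩-mono f≤f′ g≤g′ = +-mono (⨾-monoˡ f≤f′) (⨾-monoˡ g≤g′)

    [,]-cong : {f f′ : Hom A Y} {g g′ : Hom B Y} → f ≈ f′ → g ≈ g′ → [ f , g ] ≈ [ f′ , g′ ]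
    [,]-cong f≈f′ g≈g′ = +-cong (⨾-congʳ f≈f′) (⨾-congʳ g≈g′)

    ⟨,⟩-cong : {f f′ : Hom X A} {g g′ : Hom X B} → f ≈ f′ → g ≈ g′ → ⟨ f , g ⟩ ≈ ⟨ f′ , g′ ⟩
    ⟨,⟩-cong f≈f′ g≈g′ = +-cong (⨾-congˡ f≈f′) (⨾-congˡ g≈g′)

    ι-jointly-epic : {h h′ : Hom C Y} → ι₁ ⨾ h ≈ ι₁ ⨾ h′ → ι₂ ⨾ h ≈ ι₂ ⨾ h′ → h ≈ h′
    ι-jointly-epic p q = ≈-trans [,]-η (≈-trans ([,]-cong p q) (≈-sym [,]-η))

    π-jointly-monic : {h h′ : Hom X C} → h ⨾ π₁ ≈ h′ ⨾ π₁ → h ⨾ π₂ ≈ h′ ⨾ π₂ → h ≈ h′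
    π-jointly-monic p q = ≈-trans ⟨,⟩-η (≈-trans (⟨,⟩-cong p q) (≈-sym ⟨,⟩-η))

    ⟨,⟩⨾[,] : {f : Hom X A} {g : Hom X B} {h : Hom A Y} {k : Hom B Y} →
              ⟨ f , g ⟩ ⨾ [ h , k ] ≈ f ⨾ h + g ⨾ k
    ⟨,⟩⨾[,] = ≈-trans ⨾-distribʳ (+-cong (≈-trans assoc (⨾-congʳ ι₁⨾[,]))
                                          (≈-trans assoc (⨾-congʳ ι₂⨾[,])))

    ⨾-⟨,⟩ : {h : Hom Y X} {f : Hom X A} {g : Hom X B} → h ⨾ ⟨ f , g ⟩ ≈ ⟨ h ⨾ f , h ⨾ g ⟩
    ⨾-⟨,⟩ = ≈-trans ⨾-distribˡ (+-cong sym-assoc sym-assoc)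

    [,]-⨾ : {f : Hom A X} {g : Hom B X} {h : Hom X Y} → [ f , g ] ⨾ h ≈ [ f ⨾ h , g ⨾ h ]
    [,]-⨾ = ≈-trans ⨾-distribʳ (+-cong assoc assoc)

    ⟨,⟩-+ : {f f′ : Hom X A} {g g′ : Hom X B} → ⟨ f , g ⟩ + ⟨ f′ , g′ ⟩ ≈ ⟨ f + f′ , g + g′ ⟩
    ⟨,⟩-+ = ≈-trans +-interchange (≈-sym (+-cong ⨾-distribʳ ⨾-distribʳ))

    [,]-+ : {f f′ : Hom A Y} {g g′ : Hom B Y} → [ f , g ] + [ f′ , g′ ] ≈ [ f + f′ , g + g′ ]
    [,]-+ = ≈-trans +-interchange (≈-sym (+-cong ⨾-distribˡ ⨾-distribˡ))

    ⨾-split : {u : Hom X C} {w : Hom C Y} → u ⨾ w ≈ (u ⨾ π₁) ⨾ (ι₁ ⨾ w) + (u ⨾ π₂) ⨾ (ι₂ ⨾ w)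
    ⨾-split = ≈-trans (⨾-cong ⟨,⟩-η [,]-η) ⟨,⟩⨾[,]

    matrix : Hom A A → Hom A B → Hom B A → Hom B B → Hom C C
    matrix x y z v = [ ⟨ x , y ⟩ , ⟨ z , v ⟩ ]

    matrix-η : {h : Hom C C} →
               h ≈ matrix ((ι₁ ⨾ h) ⨾ π₁) ((ι₁ ⨾ h) ⨾ π₂) ((ι₂ ⨾ h) ⨾ π₁) ((ι₂ ⨾ h) ⨾ π₂)
    matrix-η = ≈-trans [,]-η ([,]-cong ⟨,⟩-η ⟨,⟩-η)

    matrix-id : id ≈ matrix id 0# 0# id
    matrix-id = ≈-trans matrix-η ([,]-cong
      (⟨,⟩-cong (≈-trans (⨾-congˡ identityʳ) ι₁⨾π₁≈id) (≈-trans (⨾-congˡ identityʳ) ι₁⨾π₂≈0#))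
      (⟨,⟩-cong (≈-trans (⨾-congˡ identityʳ) ι₂⨾π₁≈0#) (≈-trans (⨾-congˡ identityʳ) ι₂⨾π₂≈id)))

    matrix-mono : ∀ {x x′ y y′ z z′ v v′} → x ≤ x′ → y ≤ y′ → z ≤ z′ → v ≤ v′ →
                  matrix x y z v ≤ matrix x′ y′ z′ v′
    matrix-mono x≤ y≤ z≤ v≤ = [,]-mono (⟨,⟩-mono x≤ y≤) (⟨,⟩-mono z≤ v≤)

    matrix-+ : ∀ {x x′ y y′ z z′ v v′} →
               matrix x y z v + matrix x′ y′ z′ v′ ≈ matrix (x + x′) (y + y′) (z + z′) (v + v′)
    matrix-+ = ≈-trans [,]-+ ([,]-cong ⟨,⟩-+ ⟨,⟩-+)

    ⟨,⟩⨾matrix : ∀ {x y z v} {l₁ : Hom X A} {l₂ : Hom X B} →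
                 ⟨ l₁ , l₂ ⟩ ⨾ matrix x y z v ≈ ⟨ l₁ ⨾ x + l₂ ⨾ z , l₁ ⨾ y + l₂ ⨾ v ⟩
    ⟨,⟩⨾matrix = ≈-trans ⟨,⟩⨾[,] (≈-trans (+-cong ⨾-⟨,⟩ ⨾-⟨,⟩) ⟨,⟩-+)

    matrix⨾[,] : ∀ {x y z v} {r₁ : Hom A Y} {r₂ : Hom B Y} →
                 matrix x y z v ⨾ [ r₁ , r₂ ] ≈ [ x ⨾ r₁ + y ⨾ r₂ , z ⨾ r₁ + v ⨾ r₂ ]
    matrix⨾[,] = ≈-trans [,]-⨾ ([,]-cong ⟨,⟩⨾[,] ⟨,⟩⨾[,])

    ⨾matrix⨾ : ∀ {x y z v} {u : Hom X C} {w : Hom C Y} →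
               u ⨾ matrix x y z v ⨾ w
                 ≈ (u ⨾ π₁) ⨾ (x ⨾ ι₁ ⨾ w + y ⨾ ι₂ ⨾ w) + (u ⨾ π₂) ⨾ (z ⨾ ι₁ ⨾ w + v ⨾ ι₂ ⨾ w)
    ⨾matrix⨾ = ≈-trans (⨾-cong ⟨,⟩-η (≈-trans (⨾-congʳ [,]-η) matrix⨾[,])) ⟨,⟩⨾[,]

    matrix-⨾ : ∀ {x y z v x′ y′ z′ v′} →
               matrix x y z v ⨾ matrix x′ y′ z′ v′
                 ≈ matrix (x ⨾ x′ + y ⨾ z′) (x ⨾ y′ + y ⨾ v′) (z ⨾ x′ + v ⨾ z′) (z ⨾ y′ + v ⨾ v′)
    matrix-⨾ = ≈-trans [,]-⨾ ([,]-cong ⟨,⟩⨾matrix ⟨,⟩⨾matrix)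

    id+matrix⨾matrix : ∀ {x y z v x′ y′ z′ v′} →
      id + matrix x y z v ⨾ matrix x′ y′ z′ v′
        ≈ matrix (id + (x ⨾ x′ + y ⨾ z′)) (0# + (x ⨾ y′ + y ⨾ v′))
                 (0# + (z ⨾ x′ + v ⨾ z′)) (id + (z ⨾ y′ + v ⨾ v′))
    id+matrix⨾matrix = ≈-trans (+-cong matrix-id matrix-⨾) matrix-+

-- Conway's formula for the star of a block matrix M = matrix a b c d: s* is the star of the
-- Schur complement d + c a* b.
module Conway
  {o ℓ e} {R : TypedIdempotentSemiring o ℓ e} {A B C : TypedIdempotentSemiring.Obj R}
  (bp : IdempotentSemiringProperties.Biproduct R A B C)
  (SA : IdempotentSemiringProperties.KleeneStar R A)
  (SB : IdempotentSemiringProperties.KleeneStar R B) where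

  open IdempotentSemiringProperties R
  open BiproductProperties bp
  private
    module SA = KleeneStar SA
    module SB = KleeneStar SB

  module ConwayFormula (M : Hom C C) where
    a : Hom A A
    a = (ι₁ ⨾ M) ⨾ π₁
    b : Hom A B
    b = (ι₁ ⨾ M) ⨾ π₂
    c : Hom B A
    c = (ι₂ ⨾ M) ⨾ π₁
    d : Hom B B
    d = (ι₂ ⨾ M) ⨾ π₂
    a* : Hom A A
    a* = star SA a
    ca*b : Hom B B
    ca*b = c ⨾ a* ⨾ b
    s* : Hom B B
    s* = star SB (d + ca*b)

    M* : Hom C C
    M* = matrix (a* + a* ⨾ b ⨾ s* ⨾ c ⨾ a*) (a* ⨾ b ⨾ s*) (s* ⨾ c ⨾ a*) s*

    ca*b⨾s*≤s* : ca*b ⨾ s* ≤ s*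
    ca*b⨾s*≤s* = ≤-trans (⨾-monoˡ g≤f+g) SB.f⨾f*≤f*

    s*⨾ca*b≤s* : s* ⨾ ca*b ≤ s*
    s*⨾ca*b≤s* = ≤-trans (⨾-monoʳ g≤f+g) SB.f*⨾f≤f*

    d⨾s*≤s* : d ⨾ s* ≤ s*
    d⨾s*≤s* = ≤-trans (⨾-monoˡ f≤f+g) SB.f⨾f*≤f*

    s*⨾d≤s* : s* ⨾ d ≤ s*
    s*⨾d≤s* = ≤-trans (⨾-monoʳ f≤f+g) SB.f*⨾f≤f*

    ca*b-assoc : ∀ {Z} {h : Hom B Z} → c ⨾ a* ⨾ b ⨾ h ≈ ca*b ⨾ h
    ca*b-assoc = ≈-trans (⨾-congʳ sym-assoc) sym-assoc

    *-unfoldˡ : id + M ⨾ M* ≤ M*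
    *-unfoldˡ = ≈-≤-trans (≈-trans (+-congʳ (⨾-congˡ matrix-η)) id+matrix⨾matrix)
                          (matrix-mono u₁₁ u₁₂ u₂₁ u₂₂)
      where
      u₁₁ : id + (a ⨾ (a* + a* ⨾ b ⨾ s* ⨾ c ⨾ a*) + b ⨾ s* ⨾ c ⨾ a*)
              ≤ a* + a* ⨾ b ⨾ s* ⨾ c ⨾ a*
      u₁₁ = +-least (f≤g⇒f≤g+h SA.id≤f*)
              (+-least (≈-≤-trans ⨾-distribˡ (+-mono SA.f⨾f*≤f* (f⨾g≤h⇒f⨾g⨾k≤h⨾k SA.f⨾f*≤f*)))
                       (f≤h⇒f≤g+h (id≤f⇒g≤f⨾g SA.id≤f*)))
      u₁₂ : 0# + (a ⨾ a* ⨾ b ⨾ s* + b ⨾ s*) ≤ a* ⨾ b ⨾ s*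
      u₁₂ = +-least 0#≤ (+-least (f⨾g≤h⇒f⨾g⨾k≤h⨾k SA.f⨾f*≤f*) (id≤f⇒g≤f⨾g SA.id≤f*))
      u₂₁ : 0# + (c ⨾ (a* + a* ⨾ b ⨾ s* ⨾ c ⨾ a*) + d ⨾ (s* ⨾ c ⨾ a*)) ≤ s* ⨾ c ⨾ a*
      u₂₁ = +-least 0#≤ (+-least
              (≈-≤-trans ⨾-distribˡ (+-least (id≤f⇒g≤f⨾g SB.id≤f*)
                (≈-≤-trans (≈-trans ca*b-assoc sym-assoc) (⨾-monoˡ ca*b⨾s*≤s*))))
              (f⨾g≤h⇒f⨾g⨾k≤h⨾k d⨾s*≤s*))
      u₂₂ : id + (c ⨾ a* ⨾ b ⨾ s* + d ⨾ s*) ≤ s*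
      u₂₂ = +-least SB.id≤f* (+-least (≈-≤-trans ca*b-assoc ca*b⨾s*≤s*) d⨾s*≤s*)

    *-unfoldʳ : id + M* ⨾ M ≤ M*
    *-unfoldʳ = ≈-≤-trans (≈-trans (+-congʳ (⨾-congʳ matrix-η)) id+matrix⨾matrix)
                          (matrix-mono u₁₁ u₁₂ u₂₁ u₂₂)
      where
      u₁₁ : id + ((a* + a* ⨾ b ⨾ s* ⨾ c ⨾ a*) ⨾ a + (a* ⨾ b ⨾ s*) ⨾ c)
              ≤ a* + a* ⨾ b ⨾ s* ⨾ c ⨾ a*
      u₁₁ = +-least (f≤g⇒f≤g+h SA.id≤f*)
              (+-least (≈-≤-trans ⨾-distribʳ (+-mono SA.f*⨾f≤f*
                         (≈-≤-trans assoc⁴ (⨾-monoʳ (⨾-monoʳ (⨾-monoʳ (⨾-monoʳ SA.f*⨾f≤f*)))))))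
                       (f≤h⇒f≤g+h (≈-≤-trans assoc²
                         (⨾-monoʳ (⨾-monoʳ (⨾-monoʳ (id≤f⇒g≤g⨾f SA.id≤f*)))))))
      u₁₂ : 0# + ((a* + a* ⨾ b ⨾ s* ⨾ c ⨾ a*) ⨾ b + (a* ⨾ b ⨾ s*) ⨾ d) ≤ a* ⨾ b ⨾ s*
      u₁₂ = +-least 0#≤ (+-least
              (≈-≤-trans ⨾-distribʳ (+-least (⨾-monoʳ (id≤f⇒g≤g⨾f SB.id≤f*))
                (≈-≤-trans (≈-trans assoc (⨾-congʳ assoc³))
                  (⨾-monoʳ (⨾-monoʳ s*⨾ca*b≤s*)))))
              (≈-≤-trans assoc² (⨾-monoʳ (⨾-monoʳ s*⨾d≤s*))))
      u₂₁ : 0# + ((s* ⨾ c ⨾ a*) ⨾ a + s* ⨾ c) ≤ s* ⨾ c ⨾ a*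
      u₂₁ = +-least 0#≤ (+-least (≈-≤-trans assoc² (⨾-monoʳ (⨾-monoʳ SA.f*⨾f≤f*)))
                                 (⨾-monoʳ (id≤f⇒g≤g⨾f SA.id≤f*)))
      u₂₂ : id + ((s* ⨾ c ⨾ a*) ⨾ b + s* ⨾ d) ≤ s*
      u₂₂ = +-least SB.id≤f* (+-least (≈-≤-trans assoc² s*⨾ca*b≤s*) s*⨾d≤s*)

    *-inductionˡ : ∀ {Z} {r : Hom C Z} → M ⨾ r ≤ r → M* ⨾ r ≤ r
    *-inductionˡ {Z} {r} M⨾r≤r =
      ≈-≤-trans (≈-trans (⨾-congʳ [,]-η) matrix⨾[,]) (≤-≈-trans ([,]-mono g₁ g₂) (≈-sym [,]-η))
      where
      r₁ : Hom A Z
      r₁ = ι₁ ⨾ r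
      r₂ : Hom B Z
      r₂ = ι₂ ⨾ r
      h₁ : a ⨾ r₁ + b ⨾ r₂ ≤ r₁
      h₁ = ≈-≤-trans (≈-sym (≈-trans sym-assoc ⨾-split)) (⨾-monoʳ M⨾r≤r)
      h₂ : c ⨾ r₁ + d ⨾ r₂ ≤ r₂
      h₂ = ≈-≤-trans (≈-sym (≈-trans sym-assoc ⨾-split)) (⨾-monoʳ M⨾r≤r)
      a*r₁≤r₁ : a* ⨾ r₁ ≤ r₁
      a*r₁≤r₁ = SA.*-inductionˡ (f+g≤h⇒f≤h h₁)
      a*br₂≤r₁ : a* ⨾ b ⨾ r₂ ≤ r₁
      a*br₂≤r₁ = ≤-trans (⨾-monoʳ (f+g≤h⇒g≤h h₁)) a*r₁≤r₁
      s*r₂≤r₂ : s* ⨾ r₂ ≤ r₂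
      s*r₂≤r₂ = SB.*-inductionˡ (≈-≤-trans ⨾-distribʳ
        (≤-trans (+-mono ≤-refl (≈-≤-trans assoc² (⨾-monoʳ a*br₂≤r₁))) (≈-≤-trans +-comm h₂)))
      ca*r₁≤r₂ : c ⨾ a* ⨾ r₁ ≤ r₂
      ca*r₁≤r₂ = ≤-trans (⨾-monoʳ a*r₁≤r₁) (f+g≤h⇒f≤h h₂)
      a*bs*r₂≤r₁ : a* ⨾ b ⨾ s* ⨾ r₂ ≤ r₁
      a*bs*r₂≤r₁ = ≤-trans (⨾-monoʳ (⨾-monoʳ s*r₂≤r₂)) a*br₂≤r₁
      g₁ : (a* + a* ⨾ b ⨾ s* ⨾ c ⨾ a*) ⨾ r₁ + (a* ⨾ b ⨾ s*) ⨾ r₂ ≤ r₁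
      g₁ = +-least
        (≈-≤-trans ⨾-distribʳ (+-least a*r₁≤r₁ (≈-≤-trans (≈-trans assoc (⨾-congʳ assoc³))
          (≤-trans (⨾-monoʳ (⨾-monoʳ (⨾-monoʳ ca*r₁≤r₂))) a*bs*r₂≤r₁))))
        (≈-≤-trans assoc² a*bs*r₂≤r₁)
      g₂ : (s* ⨾ c ⨾ a*) ⨾ r₁ + s* ⨾ r₂ ≤ r₂
      g₂ = +-least (≈-≤-trans assoc² (≤-trans (⨾-monoʳ ca*r₁≤r₂) s*r₂≤r₂)) s*r₂≤r₂

    *-inductionʳ : ∀ {Z} {l : Hom Z C} → l ⨾ M ≤ l → l ⨾ M* ≤ l
    *-inductionʳ {Z} {l} l⨾M≤l =
      ≈-≤-trans (≈-trans (⨾-congˡ ⟨,⟩-η) ⟨,⟩⨾matrix) (≤-≈-trans (⟨,⟩-mono g₁ g₂) (≈-sym ⟨,⟩-η))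
      where
      l₁ : Hom Z A
      l₁ = l ⨾ π₁
      l₂ : Hom Z B
      l₂ = l ⨾ π₂
      entry : ∀ {X} {π : Hom C X} → (l ⨾ M) ⨾ π ≈ l₁ ⨾ (ι₁ ⨾ M) ⨾ π + l₂ ⨾ (ι₂ ⨾ M) ⨾ π
      entry = ≈-trans assoc (≈-trans ⨾-split (+-cong (⨾-congʳ sym-assoc) (⨾-congʳ sym-assoc)))
      h₁ : l₁ ⨾ a + l₂ ⨾ c ≤ l₁
      h₁ = ≈-≤-trans (≈-sym entry) (⨾-monoˡ l⨾M≤l)
      h₂ : l₁ ⨾ b + l₂ ⨾ d ≤ l₂
      h₂ = ≈-≤-trans (≈-sym entry) (⨾-monoˡ l⨾M≤l)
      l₁a*≤l₁ : l₁ ⨾ a* ≤ l₁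
      l₁a*≤l₁ = SA.*-inductionʳ (f+g≤h⇒f≤h h₁)
      l₂ca*≤l₁ : l₂ ⨾ c ⨾ a* ≤ l₁
      l₂ca*≤l₁ = ≤-trans (f⨾g≤h⇒f⨾g⨾k≤h⨾k (f+g≤h⇒g≤h h₁)) l₁a*≤l₁
      l₂s*≤l₂ : l₂ ⨾ s* ≤ l₂
      l₂s*≤l₂ = SB.*-inductionʳ (≈-≤-trans ⨾-distribˡ
        (≤-trans (+-mono ≤-refl (≈-≤-trans (≈-trans (⨾-congʳ sym-assoc) sym-assoc)
                                           (⨾-monoˡ l₂ca*≤l₁)))
                 (≈-≤-trans +-comm h₂)))
      l₁bs*≤l₂ : l₁ ⨾ b ⨾ s* ≤ l₂
      l₁bs*≤l₂ = ≤-trans (f⨾g≤h⇒f⨾g⨾k≤h⨾k (f+g≤h⇒f≤h h₂)) l₂s*≤l₂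
      l₂s*ca*≤l₁ : l₂ ⨾ s* ⨾ c ⨾ a* ≤ l₁
      l₂s*ca*≤l₁ = ≤-trans (f⨾g≤h⇒f⨾g⨾k≤h⨾k l₂s*≤l₂) l₂ca*≤l₁
      g₁ : l₁ ⨾ (a* + a* ⨾ b ⨾ s* ⨾ c ⨾ a*) + l₂ ⨾ s* ⨾ c ⨾ a* ≤ l₁
      g₁ = +-least (≈-≤-trans ⨾-distribˡ (+-least l₁a*≤l₁
             (≤-trans (f⨾g≤h⇒f⨾g⨾k≤h⨾k l₁a*≤l₁)
               (≤-trans (f⨾g≤h⇒f⨾g⨾k≤h⨾k (f+g≤h⇒f≤h h₂)) l₂s*ca*≤l₁))))
             l₂s*ca*≤l₁
      g₂ : l₁ ⨾ a* ⨾ b ⨾ s* + l₂ ⨾ s* ≤ l₂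
      g₂ = +-least (≤-trans (f⨾g≤h⇒f⨾g⨾k≤h⨾k l₁a*≤l₁) l₁bs*≤l₂) l₂s*≤l₂

  conwayStar : KleeneStar C
  conwayStar = record
    { star = ConwayFormula.M*
    ; *-unfoldˡ = λ {M} → ConwayFormula.*-unfoldˡ M
    ; *-unfoldʳ = λ {M} → ConwayFormula.*-unfoldʳ M
    ; *-inductionˡ = λ {_} {M} → ConwayFormula.*-inductionˡ M
    ; *-inductionʳ = λ {_} {M} → ConwayFormula.*-inductionʳ M
    }

idempotentSemiring : ∀ {o ℓ e} → TypedKleeneAlgebra o ℓ e → TypedIdempotentSemiring o ℓ e
idempotentSemiring K = record
  { Obj = Obj ; Hom = Hom ; _≈_ = _≈_ ; ≈-refl = ≈-refl ; ≈-sym = ≈-sym ; ≈-trans = ≈-trans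
  ; id = id ; _⨾_ = _⨾_ ; ⨾-cong = ⨾-cong ; identityˡ = identityˡ ; identityʳ = identityʳ
  ; assoc = assoc ; _+_ = _+_ ; 0# = 0# ; +-cong = +-cong ; +-assoc = +-assoc ; +-comm = +-comm
  ; +-idem = +-idem ; +-identityˡ = +-identityˡ ; ⨾-distribˡ = ⨾-distribˡ ; ⨾-distribʳ = ⨾-distribʳ
  ; ⨾-zeroʳ = ⨾-zeroʳ ; ⨾-zeroˡ = ⨾-zeroˡ }
  where open TypedKleeneAlgebra K

module Matrices {o ℓ e} (K : TypedKleeneAlgebra o ℓ e) where
  open MatConstruction K public
  private
    module K = IdempotentSemiringProperties (idempotentSemiring K)
  open K using (Obj; Hom; _≈_; _⨾_; _+_; 0#; ≈-refl; ≈-sym; ≈-trans; +-cong; +-congˡ; +-congʳ;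
                ⨾-congˡ; ⨾-congʳ; +-identityˡ; +-identityʳ; +-idem)

  private variable
    X Y Z : Obj

  sum-cong : ∀ n {f g : Fin n → Hom X Y} → (∀ i → f i ≈ g i) → sumFin n f ≈ sumFin n g
  sum-cong zero    f≈g = ≈-refl
  sum-cong (suc n) f≈g = +-cong (f≈g zero) (sum-cong n (f≈g ∘ suc))

  sum-0# : ∀ n {f : Fin n → Hom X Y} → (∀ i → f i ≈ 0#) → sumFin n f ≈ 0#
  sum-0# zero    f≈0 = ≈-refl
  sum-0# (suc n) f≈0 = ≈-trans (+-cong (f≈0 zero) (sum-0# n (f≈0 ∘ suc))) +-idem

  sum-δ : ∀ n (i : Fin n) {f : Fin n → Hom X Y} → (∀ j → j ≢ i → f j ≈ 0#) → sumFin n f ≈ f i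
  sum-δ (suc n) zero    f≈0 = ≈-trans (+-congʳ (sum-0# n (λ j → f≈0 (suc j) λ ()))) +-identityʳ
  sum-δ (suc n) (suc i) f≈0 = ≈-trans
    (+-cong (f≈0 zero λ ()) (sum-δ n i (λ j j≢i → f≈0 (suc j) (j≢i ∘ suc-injective))))
    +-identityˡ

  sum-+ : ∀ n {f g : Fin n → Hom X Y} → sumFin n (λ i → f i + g i) ≈ sumFin n f + sumFin n g
  sum-+ zero    = ≈-sym +-idem
  sum-+ (suc n) = ≈-trans (+-congʳ (sum-+ n)) K.+-interchange

  ⨾-sum : ∀ n {h : Hom X Y} {f : Fin n → Hom Y Z} → h ⨾ sumFin n f ≈ sumFin n (λ i → h ⨾ f i)
  ⨾-sum zero    = K.⨾-zeroʳ
  ⨾-sum (suc n) = ≈-trans K.⨾-distribˡ (+-congʳ (⨾-sum n))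

  sum-⨾ : ∀ n {h : Hom Y Z} {f : Fin n → Hom X Y} → sumFin n f ⨾ h ≈ sumFin n (λ i → f i ⨾ h)
  sum-⨾ zero    = K.⨾-zeroˡ
  sum-⨾ (suc n) = ≈-trans K.⨾-distribʳ (+-congʳ (sum-⨾ n))

  sum-swap : ∀ m n {f : Fin m → Fin n → Hom X Y} →
             sumFin m (λ i → sumFin n (f i)) ≈ sumFin n (λ j → sumFin m (λ i → f i j))
  sum-swap zero    n = ≈-sym (sum-0# n (λ _ → ≈-refl))
  sum-swap (suc m) n = ≈-trans (+-congʳ (sum-swap m n)) (≈-sym (sum-+ n))

  sum-splitAt : ∀ m n {f : Fin m ⊎ Fin n → Hom X Y} →
                sumFin (m +ℕ n) (f ∘ splitAt m) ≈ sumFin m (f ∘ inj₁) + sumFin n (f ∘ inj₂)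
  sum-splitAt zero    n     = ≈-sym +-identityˡ
  sum-splitAt (suc m) n {f} = ≈-trans (+-congʳ (sum-splitAt m n {f ∘ map₁ suc})) (≈-sym K.+-assoc)

  idM-diag : (A : MObj) (i : Fin (size A)) → idM A i i ≈ K.id
  idM-diag A i with i ≟ i
  ... | yes refl = ≈-refl
  ... | no i≢i   = ⊥-elim (i≢i refl)

  idM-off : (A : MObj) {j i : Fin (size A)} → j ≢ i → idM A j i ≈ 0#
  idM-off A {j} {i} j≢i with i ≟ j
  ... | yes i≡j = ⊥-elim (j≢i (sym i≡j))
  ... | no _    = ≈-refl

  sum-idMˡ : (A : MObj) {f : (j : Fin (size A)) → Hom (at A j) Y} (i : Fin (size A)) →
             sumFin (size A) (λ j → idM A j i ⨾ f j) ≈ f i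
  sum-idMˡ A i = ≈-trans
    (sum-δ (size A) i (λ j j≢i → ≈-trans (⨾-congˡ (idM-off A j≢i)) K.⨾-zeroˡ))
    (≈-trans (⨾-congˡ (idM-diag A i)) K.identityˡ)

  sum-idMʳ : (A : MObj) {f : (j : Fin (size A)) → Hom X (at A j)} (k : Fin (size A)) →
             sumFin (size A) (λ j → f j ⨾ idM A k j) ≈ f k
  sum-idMʳ A k = ≈-trans
    (sum-δ (size A) k (λ j j≢k → ≈-trans (⨾-congʳ (idM-off A (j≢k ∘ sym))) K.⨾-zeroʳ))
    (≈-trans (⨾-congʳ (idM-diag A k)) K.identityʳ)

  ⨾M-assoc : {A B C D : MObj} (f : MHom A B) (g : MHom B C) (h : MHom C D) →
             ((f ⨾M g) ⨾M h) ≈M (f ⨾M (g ⨾M h))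
  ⨾M-assoc {B = B} {C} f g h k i = begin
    sumFin (size C) (λ l → sumFin (size B) (λ j → f j i ⨾ g l j) ⨾ h k l)
      ≈⟨ sum-cong (size C) (λ l → ≈-trans (sum-⨾ (size B)) (sum-cong (size B) (λ j → K.assoc))) ⟩
    sumFin (size C) (λ l → sumFin (size B) (λ j → f j i ⨾ (g l j ⨾ h k l)))
      ≈⟨ sum-swap (size C) (size B) ⟩
    sumFin (size B) (λ j → sumFin (size C) (λ l → f j i ⨾ (g l j ⨾ h k l)))
      ≈⟨ sum-cong (size B) (λ j → ⨾-sum (size C)) ⟨
    sumFin (size B) (λ j → f j i ⨾ sumFin (size C) (λ l → g l j ⨾ h k l)) ∎
    where open K.≈-Reasoning

  matSemiring : TypedIdempotentSemiring o ℓ e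
  matSemiring = record
    { Obj = MObj ; Hom = MHom ; _≈_ = _≈M_
    ; ≈-refl = λ j i → ≈-refl
    ; ≈-sym = λ p j i → ≈-sym (p j i)
    ; ≈-trans = λ p q j i → ≈-trans (p j i) (q j i)
    ; id = λ {A} → idM A ; _⨾_ = _⨾M_
    ; ⨾-cong = λ {A} {B} p q k i → sum-cong (size B) (λ j → K.⨾-cong (p j i) (q k j))
    ; identityˡ = λ {A} k i → sum-idMˡ A i
    ; identityʳ = λ {A} {B} k i → sum-idMʳ B k
    ; assoc = λ {_} {_} {_} {_} {f} {g} {h} → ⨾M-assoc f g h
    ; _+_ = λ M N j i → M j i + N j i
    ; 0# = λ j i → 0#
    ; +-cong = λ p q j i → +-cong (p j i) (q j i)
    ; +-assoc = λ j i → K.+-assoc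
    ; +-comm = λ j i → K.+-comm
    ; +-idem = λ j i → +-idem
    ; +-identityˡ = λ j i → +-identityˡ
    ; ⨾-distribˡ = λ {A} {B} k i → ≈-trans (sum-cong (size B) (λ j → K.⨾-distribˡ)) (sum-+ (size B))
    ; ⨾-distribʳ = λ {A} {B} k i → ≈-trans (sum-cong (size B) (λ j → K.⨾-distribʳ)) (sum-+ (size B))
    ; ⨾-zeroʳ = λ {A} {B} k i → sum-0# (size B) (λ j → K.⨾-zeroʳ)
    ; ⨾-zeroˡ = λ {A} {B} k i → sum-0# (size B) (λ j → K.⨾-zeroˡ)
    }

  private
    module M = IdempotentSemiringProperties matSemiring

  module _ (A B : MObj) where
    private
      a b : ℕ
      a = size A
      b = size B

    -- the identity of A ⊕O B, indexed by Fin a ⊎ Fin b rather than Fin (a + b)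
    I : (y x : Fin a ⊎ Fin b) → Hom ([ at A , at B ]′ x) ([ at A , at B ]′ y)
    I = blk (idM A) (idM B)

    I⨾I : ∀ z x →
          sumFin a (λ j → I (inj₁ j) x ⨾ I z (inj₁ j)) + sumFin b (λ j → I (inj₂ j) x ⨾ I z (inj₂ j))
            ≈ I z x
    I⨾I (inj₁ k) (inj₁ i) = ≈-trans (+-cong (sum-idMˡ A i) (sum-0# b (λ _ → K.⨾-zeroˡ))) +-identityʳ
    I⨾I (inj₂ k) (inj₂ i) = ≈-trans (+-cong (sum-0# a (λ _ → K.⨾-zeroˡ)) (sum-idMˡ B i)) +-identityˡ
    I⨾I (inj₁ k) (inj₂ i) = ≈-trans (+-cong (sum-0# a (λ _ → K.⨾-zeroˡ)) (sum-0# b (λ _ → K.⨾-zeroʳ)))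
                                    +-idem
    I⨾I (inj₂ k) (inj₁ i) = ≈-trans (+-cong (sum-0# a (λ _ → K.⨾-zeroʳ)) (sum-0# b (λ _ → K.⨾-zeroˡ)))
                                    +-idem

    sum-I⨾I : ∀ z x → sumFin (a +ℕ b) (λ j → I (splitAt a j) x ⨾ I z (splitAt a j)) ≈ I z x
    sum-I⨾I z x = ≈-trans (sum-splitAt a b {f = λ y → I y x ⨾ I z y}) (I⨾I z x)

    idM-⊕O : ∀ k i → idM (A ⊕O B) k i ≈ I (splitAt a k) (splitAt a i)
    idM-⊕O k i with i ≟ k
    ... | yes refl = I-diag (splitAt a i)
      where
      I-diag : ∀ x → K.id ≈ I x x
      I-diag (inj₁ x) = ≈-sym (idM-diag A x)
      I-diag (inj₂ x) = ≈-sym (idM-diag B x)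
    ... | no i≢k = I-off (i≢k ∘ splitAt-injective)
      where
      splitAt-injective : ∀ {i k : Fin (a +ℕ b)} → splitAt a i ≡ splitAt a k → i ≡ k
      splitAt-injective = Injection.injective (↔⇒↣ +↔⊎)
      I-off : ∀ {z x} → x ≢ z → 0# ≈ I z x
      I-off {inj₁ z} {inj₁ x} x≢z = ≈-sym (idM-off A (x≢z ∘ cong inj₁ ∘ sym))
      I-off {inj₂ z} {inj₂ x} x≢z = ≈-sym (idM-off B (x≢z ∘ cong inj₂ ∘ sym))
      I-off {inj₁ z} {inj₂ x} _   = ≈-refl
      I-off {inj₂ z} {inj₁ x} _   = ≈-refl

    ⊕O-biproduct : M.Biproduct A B (A ⊕O B)
    ⊕O-biproduct = record
      { ι₁ = λ j i → I (splitAt a j) (inj₁ i)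
      ; ι₂ = λ j i → I (splitAt a j) (inj₂ i)
      ; π₁ = λ k j → I (inj₁ k) (splitAt a j)
      ; π₂ = λ k j → I (inj₂ k) (splitAt a j)
      ; ι₁⨾π₁≈id = λ k i → sum-I⨾I (inj₁ k) (inj₁ i)
      ; ι₂⨾π₂≈id = λ k i → sum-I⨾I (inj₂ k) (inj₂ i)
      ; ι₁⨾π₂≈0# = λ k i → sum-I⨾I (inj₂ k) (inj₁ i)
      ; ι₂⨾π₁≈0# = λ k i → sum-I⨾I (inj₁ k) (inj₂ i)
      ; π₁⨾ι₁+π₂⨾ι₂≈id = λ k i → ≈-trans (I⨾I (splitAt a k) (splitAt a i)) (≈-sym (idM-⊕O k i))
      }

  𝟘M-initial : {X : MObj} (f g : MHom 𝟘M X) → f ≈M g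
  𝟘M-initial f g j ()

  𝟘M-terminal : {X : MObj} (f g : MHom X 𝟘M) → f ≈M g
  𝟘M-terminal f g ()

  private
    ι₁ : (A B : MObj) → MHom A (A ⊕O B)
    ι₁ A B = M.Biproduct.ι₁ (⊕O-biproduct A B)
    ι₂ : (A B : MObj) → MHom B (A ⊕O B)
    ι₂ A B = M.Biproduct.ι₂ (⊕O-biproduct A B)

  module _ {A B C D : MObj} (M : MHom A B) (N : MHom C D) where
    private
      a b c d : ℕ
      a = size A
      b = size B
      c = size C
      d = size D

    ι₁⨾⊕M : (ι₁ A C ⨾M (M ⊕M N)) ≈M (M ⨾M ι₁ B D)
    ι₁⨾⊕M k i = ≈-trans (sum-splitAt a c {f = λ y → I A C y (inj₁ i) ⨾ blk M N (splitAt b k) y})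
                  (≈-trans (≈-trans (+-cong (sum-idMˡ A i) (sum-0# c (λ _ → K.⨾-zeroˡ))) +-identityʳ)
                           (≈-sym (M⨾I (splitAt b k))))
      where
      M⨾I : ∀ y → sumFin b (λ j → M j i ⨾ I B D y (inj₁ j)) ≈ blk M N y (inj₁ i)
      M⨾I (inj₁ k) = sum-idMʳ B k
      M⨾I (inj₂ k) = sum-0# b (λ _ → K.⨾-zeroʳ)

    ι₂⨾⊕M : (ι₂ A C ⨾M (M ⊕M N)) ≈M (N ⨾M ι₂ B D)
    ι₂⨾⊕M k i = ≈-trans (sum-splitAt a c {f = λ y → I A C y (inj₂ i) ⨾ blk M N (splitAt b k) y})
                  (≈-trans (≈-trans (+-cong (sum-0# a (λ _ → K.⨾-zeroˡ)) (sum-idMˡ C i)) +-identityˡ)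
                           (≈-sym (N⨾I (splitAt b k))))
      where
      N⨾I : ∀ y → sumFin d (λ j → N j i ⨾ I B D y (inj₂ j)) ≈ blk M N y (inj₂ i)
      N⨾I (inj₁ k) = sum-0# d (λ _ → K.⨾-zeroʳ)
      N⨾I (inj₂ k) = sum-idMʳ D k

  module _ (n : ℕ) (at′ : Fin (suc n) → Obj) where
    private
      A : MObj
      A = mobj (suc n) at′

    idM-suc : ∀ k i → idM A (suc k) (suc i) ≈ idM (mobj n (at′ ∘ suc)) k i
    idM-suc k i with i ≟ k
    ... | yes refl = ≈-refl
    ... | no _     = ≈-refl

    idM⨾idM : ∀ k i → sumFin (suc n) (λ j → idM A j i ⨾ idM A k j) ≈ idM A k i
    idM⨾idM k i = sum-idMˡ A {f = idM A k} i

    head-tail-biproduct : M.Biproduct (mobj 1 (λ _ → at′ zero)) (mobj n (at′ ∘ suc)) A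
    head-tail-biproduct = record
      { ι₁ = λ j _ → idM A j zero
      ; ι₂ = λ j i → idM A j (suc i)
      ; π₁ = λ _ j → idM A zero j
      ; π₂ = λ k j → idM A (suc k) j
      ; ι₁⨾π₁≈id = λ { zero zero → idM⨾idM zero zero }
      ; ι₂⨾π₂≈id = λ k i → ≈-trans (idM⨾idM (suc k) (suc i)) (idM-suc k i)
      ; ι₁⨾π₂≈0# = λ { k zero → ≈-trans (idM⨾idM (suc k) zero) (idM-off A λ ()) }
      ; ι₂⨾π₁≈0# = λ { zero i → ≈-trans (idM⨾idM zero (suc i)) (idM-off A λ ()) }
      ; π₁⨾ι₁+π₂⨾ι₂≈id = λ k i → ≈-trans (+-congˡ +-identityʳ) (idM⨾idM k i)
      }

  matBiproducts : M.HasBiproducts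
  matBiproducts = record
    { _⊕₀_ = _⊕O_ ; _⊕₁_ = _⊕M_ ; 𝟘 = 𝟘M ; biproduct = ⊕O-biproduct
    ; ι₁⨾⊕ = λ {_ _ _ _ f g} → ι₁⨾⊕M f g ; ι₂⨾⊕ = λ {_ _ _ _ f g} → ι₂⨾⊕M f g
    ; 𝟘-initial = 𝟘M-initial ; 𝟘-terminal = 𝟘M-terminal }

  open TypedKleeneAlgebra K using (_*; *-unfoldˡ; *-unfoldʳ; *-inductionˡ; *-inductionʳ)

  singletonStar : (X : Obj) → M.KleeneStar (mobj 1 (λ _ → X))
  singletonStar X = record
    { star = λ F _ _ → F zero zero *
    ; *-unfoldˡ = λ { zero zero → ≈-trans (+-congˡ (+-congʳ +-identityʳ)) *-unfoldˡ }
    ; *-unfoldʳ = λ { zero zero → ≈-trans (+-congˡ (+-congʳ +-identityʳ)) *-unfoldʳ }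
    ; *-inductionˡ = λ F⨾r≤r k → λ { zero → ≈-trans (+-congˡ +-identityʳ)
        (*-inductionˡ (≈-trans (+-congˡ (≈-sym +-identityʳ)) (F⨾r≤r k zero))) }
    ; *-inductionʳ = λ l⨾F≤l → λ { zero i → ≈-trans (+-congˡ +-identityʳ)
        (*-inductionʳ (≈-trans (+-congˡ (≈-sym +-identityʳ)) (l⨾F≤l zero i))) }
    }

  emptyStar : (at′ : Fin 0 → Obj) → M.KleeneStar (mobj 0 at′)
  emptyStar at′ = record
    { star = λ _ ()
    ; *-unfoldˡ = λ ()
    ; *-unfoldʳ = λ ()
    ; *-inductionˡ = λ _ _ ()
    ; *-inductionʳ = λ _ ()
    }

  matStar : (A : MObj) → M.KleeneStar A
  matStar A = byLength (size A) (at A)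
    where
    byLength : (n : ℕ) (at′ : Fin n → Obj) → M.KleeneStar (mobj n at′)
    byLength zero    at′ = emptyStar at′
    byLength (suc n) at′ = Conway.conwayStar (head-tail-biproduct n at′)
                             (singletonStar (at′ zero)) (byLength n (at′ ∘ suc))

module BiproductKleeneBicategory
  {o ℓ e} {R : TypedIdempotentSemiring o ℓ e}
  (biproducts : IdempotentSemiringProperties.HasBiproducts R)
  (stars : ∀ A → IdempotentSemiringProperties.KleeneStar R A) where

  open IdempotentSemiringProperties R
  open HasBiproducts biproducts

  private variable
    A A′ B B′ C C′ D E F S T U V W X X′ Y Y′ Z : Obj

  module _ {A B : Obj} where
    open BiproductProperties (biproduct A B) public
      using (ι₁; ι₂; π₁; π₂; ι₁⨾π₁≈id; ι₂⨾π₂≈id; ι₁⨾π₂≈0#; ι₂⨾π₁≈0#;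
             ι₁⨾π₁⨾; ι₂⨾π₂⨾; ι₁⨾π₂⨾; ι₂⨾π₁⨾; ⨾ι₁⨾π₁; ⨾ι₂⨾π₂; ⨾ι₁⨾π₂; ⨾ι₂⨾π₁;
             [_,_]; ⟨_,_⟩; ι₁⨾[,]; ι₂⨾[,]; ⟨,⟩⨾π₁; ⟨,⟩⨾π₂; ⟨,⟩⨾[,]; [,]-⨾; [,]-η; [,]-cong; [,]-mono;
             ι-jointly-epic; π-jointly-monic)

  private
    reassoc : {a : Hom X Y} {b : Hom Y Z} {f g : Hom Z W} →
             (a ⨾ b) ⨾ f ≈ (a ⨾ b) ⨾ g → a ⨾ (b ⨾ f) ≈ a ⨾ (b ⨾ g)
    reassoc p = ≈-trans sym-assoc (≈-trans p assoc)

  infixr 4 _▸_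
  infixl 4 _◂_

  -- diagram chasing: follow u through the composite F ⨾ G one factor at a time
  _▸_ : {u : Hom X Y} {F : Hom Y Z} {G : Hom Z W} {v : Hom X Z} {w : Hom X W} →
        u ⨾ F ≈ v → v ⨾ G ≈ w → u ⨾ (F ⨾ G) ≈ w
  p ▸ q = ≈-trans sym-assoc (≈-trans (⨾-congˡ p) q)

  _◂_ : {G : Hom X Y} {F : Hom Y Z} {v : Hom Z W} {w : Hom Y W} {z : Hom X W} →
        F ⨾ v ≈ w → G ⨾ w ≈ z → (G ⨾ F) ⨾ v ≈ z
  p ◂ q = ≈-trans assoc (≈-trans (⨾-congʳ p) q)

  agree : {f g h : Hom X Y} → f ≈ h → g ≈ h → f ≈ g
  agree p q = ≈-trans p (≈-sym q)

  pullʳ : {f : Hom X Y} {g : Hom Y Z} {h : Hom Z W} {k : Hom Y W} →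
          g ⨾ h ≈ k → (f ⨾ g) ⨾ h ≈ f ⨾ k
  pullʳ p = ≈-trans assoc (⨾-congʳ p)

  pullʳ₂ : {f : Hom X Y} {g : Hom Y Z} {g′ : Hom Z U} {h : Hom U W} {k : Hom Y W} →
           (g ⨾ g′) ⨾ h ≈ k → ((f ⨾ g) ⨾ g′) ⨾ h ≈ f ⨾ k
  pullʳ₂ p = ≈-trans (⨾-congˡ assoc) (pullʳ p)

  ι₁⨾⊕′ : {x : Hom X A} {f : Hom A B} {g : Hom C D} {w : Hom X B} →
          x ⨾ f ≈ w → (x ⨾ ι₁) ⨾ (f ⊕₁ g) ≈ w ⨾ ι₁
  ι₁⨾⊕′ p = ≈-trans (pullʳ ι₁⨾⊕) (≈-trans sym-assoc (⨾-congˡ p))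

  ι₂⨾⊕′ : {x : Hom X C} {f : Hom A B} {g : Hom C D} {w : Hom X D} →
          x ⨾ g ≈ w → (x ⨾ ι₂) ⨾ (f ⊕₁ g) ≈ w ⨾ ι₂
  ι₂⨾⊕′ p = ≈-trans (pullʳ ι₂⨾⊕) (≈-trans sym-assoc (⨾-congˡ p))

  ι₁⨾id⊕ : {g : Hom C D} → ι₁ ⨾ (id {A} ⊕₁ g) ≈ ι₁
  ι₁⨾id⊕ = ≈-trans ι₁⨾⊕ identityˡ

  ι₂⨾⊕id : {f : Hom A B} → ι₂ ⨾ (f ⊕₁ id {C}) ≈ ι₂
  ι₂⨾⊕id = ≈-trans ι₂⨾⊕ identityˡ

  ι-jointly-epic₃ : {f g : Hom ((A ⊕₀ B) ⊕₀ C) Z} →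
    (ι₁ ⨾ ι₁) ⨾ f ≈ (ι₁ ⨾ ι₁) ⨾ g → (ι₂ ⨾ ι₁) ⨾ f ≈ (ι₂ ⨾ ι₁) ⨾ g → ι₂ ⨾ f ≈ ι₂ ⨾ g → f ≈ g
  ι-jointly-epic₃ p q r = ι-jointly-epic (ι-jointly-epic (reassoc p) (reassoc q)) r

  ι-jointly-epic₃′ : {f g : Hom (A ⊕₀ (B ⊕₀ C)) Z} →
    ι₁ ⨾ f ≈ ι₁ ⨾ g → (ι₁ ⨾ ι₂) ⨾ f ≈ (ι₁ ⨾ ι₂) ⨾ g → (ι₂ ⨾ ι₂) ⨾ f ≈ (ι₂ ⨾ ι₂) ⨾ g → f ≈ g
  ι-jointly-epic₃′ p q r = ι-jointly-epic p (ι-jointly-epic (reassoc q) (reassoc r))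

  ι-jointly-epic₄ : {f g : Hom (((A ⊕₀ B) ⊕₀ C) ⊕₀ D) Z} →
    ((ι₁ ⨾ ι₁) ⨾ ι₁) ⨾ f ≈ ((ι₁ ⨾ ι₁) ⨾ ι₁) ⨾ g → ((ι₂ ⨾ ι₁) ⨾ ι₁) ⨾ f ≈ ((ι₂ ⨾ ι₁) ⨾ ι₁) ⨾ g →
    (ι₂ ⨾ ι₁) ⨾ f ≈ (ι₂ ⨾ ι₁) ⨾ g → ι₂ ⨾ f ≈ ι₂ ⨾ g → f ≈ g
  ι-jointly-epic₄ p q r s = ι-jointly-epic (ι-jointly-epic₃ (reassoc p) (reassoc q) (reassoc r)) s

  ι-jointly-epic₂₂ : {f g : Hom ((A ⊕₀ B) ⊕₀ (C ⊕₀ D)) Z} →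
    (ι₁ ⨾ ι₁) ⨾ f ≈ (ι₁ ⨾ ι₁) ⨾ g → (ι₂ ⨾ ι₁) ⨾ f ≈ (ι₂ ⨾ ι₁) ⨾ g →
    (ι₁ ⨾ ι₂) ⨾ f ≈ (ι₁ ⨾ ι₂) ⨾ g → (ι₂ ⨾ ι₂) ⨾ f ≈ (ι₂ ⨾ ι₂) ⨾ g → f ≈ g
  ι-jointly-epic₂₂ p q r s = ι-jointly-epic (ι-jointly-epic (reassoc p) (reassoc q))
                                            (ι-jointly-epic (reassoc r) (reassoc s))

  ⊕⨾π₁ : {f : Hom A B} {g : Hom C D} → (f ⊕₁ g) ⨾ π₁ ≈ π₁ ⨾ f
  ⊕⨾π₁ = ι-jointly-epic (agree (ι₁⨾⊕ ▸ ⨾ι₁⨾π₁) ι₁⨾π₁⨾) (agree (ι₂⨾⊕ ▸ ⨾ι₂⨾π₁) ι₂⨾π₁⨾)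

  ⊕⨾π₂ : {f : Hom A B} {g : Hom C D} → (f ⊕₁ g) ⨾ π₂ ≈ π₂ ⨾ g
  ⊕⨾π₂ = ι-jointly-epic (agree (ι₁⨾⊕ ▸ ⨾ι₁⨾π₂) ι₁⨾π₂⨾) (agree (ι₂⨾⊕ ▸ ⨾ι₂⨾π₂) ι₂⨾π₂⨾)

  ⊕≈[,] : {f : Hom A B} {g : Hom C D} → f ⊕₁ g ≈ [ f ⨾ ι₁ , g ⨾ ι₂ ]
  ⊕≈[,] = ι-jointly-epic (agree ι₁⨾⊕ ι₁⨾[,]) (agree ι₂⨾⊕ ι₂⨾[,])

  ⊕-mono : {f f′ : Hom A B} {g g′ : Hom C D} → f ≤ f′ → g ≤ g′ → f ⊕₁ g ≤ f′ ⊕₁ g′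
  ⊕-mono f≤f′ g≤g′ =
    ≈-≤-trans ⊕≈[,] (≤-≈-trans ([,]-mono (⨾-monoˡ f≤f′) (⨾-monoˡ g≤g′)) (≈-sym ⊕≈[,]))

  ⊕-cong : {f f′ : Hom A B} {g g′ : Hom C D} → f ≈ f′ → g ≈ g′ → f ⊕₁ g ≈ f′ ⊕₁ g′
  ⊕-cong p q = ≤-antisym (⊕-mono (≤-reflexive p) (≤-reflexive q))
                         (⊕-mono (≤-reflexive (≈-sym p)) (≤-reflexive (≈-sym q)))

  ⊕-id : id {A} ⊕₁ id {B} ≈ id
  ⊕-id = ι-jointly-epic (agree ι₁⨾id⊕ identityʳ) (agree ι₂⨾⊕id identityʳ)

  ⊕-⨾ : {f : Hom A B} {g : Hom B C} {h : Hom D E} {k : Hom E F} →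
        (f ⨾ g) ⊕₁ (h ⨾ k) ≈ (f ⊕₁ h) ⨾ (g ⊕₁ k)
  ⊕-⨾ = ι-jointly-epic (agree ι₁⨾⊕ (ι₁⨾⊕ ▸ ι₁⨾⊕′ ≈-refl)) (agree ι₂⨾⊕ (ι₂⨾⊕ ▸ ι₂⨾⊕′ ≈-refl))

  α : (A B C : Obj) → Hom ((A ⊕₀ B) ⊕₀ C) (A ⊕₀ (B ⊕₀ C))
  α A B C = [ [ ι₁ , ι₁ ⨾ ι₂ ] , ι₂ ⨾ ι₂ ]

  α⁻¹ : (A B C : Obj) → Hom (A ⊕₀ (B ⊕₀ C)) ((A ⊕₀ B) ⊕₀ C)
  α⁻¹ A B C = [ ι₁ ⨾ ι₁ , [ ι₂ ⨾ ι₁ , ι₂ ] ]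

  lu : (A : Obj) → Hom (𝟘 ⊕₀ A) A
  lu A = [ 0# , id ]

  ru : (A : Obj) → Hom (A ⊕₀ 𝟘) A
  ru A = [ id , 0# ]

  σ : (A B : Obj) → Hom (A ⊕₀ B) (B ⊕₀ A)
  σ A B = [ ι₂ , ι₁ ]

  ∇ : (X : Obj) → Hom (X ⊕₀ X) X
  ∇ X = [ id , id ]

  Δ : (X : Obj) → Hom X (X ⊕₀ X)
  Δ X = ⟨ id , id ⟩

  ι₁ι₁⨾α : (ι₁ ⨾ ι₁) ⨾ α A B C ≈ ι₁
  ι₁ι₁⨾α = ≈-trans (pullʳ ι₁⨾[,]) ι₁⨾[,]
  ι₂ι₁⨾α : (ι₂ ⨾ ι₁) ⨾ α A B C ≈ ι₁ ⨾ ι₂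
  ι₂ι₁⨾α = ≈-trans (pullʳ ι₁⨾[,]) ι₂⨾[,]
  ι₂⨾α : ι₂ ⨾ α A B C ≈ ι₂ ⨾ ι₂
  ι₂⨾α = ι₂⨾[,]

  ι₁⨾α⁻¹ : ι₁ ⨾ α⁻¹ A B C ≈ ι₁ ⨾ ι₁
  ι₁⨾α⁻¹ = ι₁⨾[,]
  ι₁ι₂⨾α⁻¹ : (ι₁ ⨾ ι₂) ⨾ α⁻¹ A B C ≈ ι₂ ⨾ ι₁
  ι₁ι₂⨾α⁻¹ = ≈-trans (pullʳ ι₂⨾[,]) ι₁⨾[,]
  ι₂ι₂⨾α⁻¹ : (ι₂ ⨾ ι₂) ⨾ α⁻¹ A B C ≈ ι₂
  ι₂ι₂⨾α⁻¹ = ≈-trans (pullʳ ι₂⨾[,]) ι₂⨾[,]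

  α-isoˡ : α A B C ⨾ α⁻¹ A B C ≈ id
  α-isoˡ = ι-jointly-epic₃ (agree (ι₁ι₁⨾α ▸ ι₁⨾α⁻¹) identityʳ) (agree (ι₂ι₁⨾α ▸ ι₁ι₂⨾α⁻¹) identityʳ)
                           (agree (ι₂⨾α ▸ ι₂ι₂⨾α⁻¹) identityʳ)

  α-isoʳ : α⁻¹ A B C ⨾ α A B C ≈ id
  α-isoʳ = ι-jointly-epic₃′ (agree (ι₁⨾α⁻¹ ▸ ι₁ι₁⨾α) identityʳ) (agree (ι₁ι₂⨾α⁻¹ ▸ ι₂ι₁⨾α) identityʳ)
                            (agree (ι₂ι₂⨾α⁻¹ ▸ ι₂⨾α) identityʳ)

  α-natural : {f : Hom A A′} {g : Hom B B′} {h : Hom C C′} →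
              ((f ⊕₁ g) ⊕₁ h) ⨾ α A′ B′ C′ ≈ α A B C ⨾ (f ⊕₁ (g ⊕₁ h))
  α-natural = ι-jointly-epic₃
    (agree (ι₁⨾⊕′ ι₁⨾⊕ ▸ pullʳ₂ ι₁ι₁⨾α) (ι₁ι₁⨾α ▸ ι₁⨾⊕))
    (agree (ι₁⨾⊕′ ι₂⨾⊕ ▸ pullʳ₂ ι₂ι₁⨾α) (ι₂ι₁⨾α ▸ ≈-trans (ι₂⨾⊕′ ι₁⨾⊕) assoc))
    (agree (ι₂⨾⊕ ▸ pullʳ ι₂⨾α) (ι₂⨾α ▸ ≈-trans (ι₂⨾⊕′ ι₂⨾⊕) assoc))

  lu-isoˡ : lu A ⨾ ι₂ ≈ id
  lu-isoˡ = ι-jointly-epic (𝟘-initial _ _) (agree (ι₂⨾[,] ▸ identityˡ) identityʳ)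

  lu-natural : {f : Hom A B} → (id {𝟘} ⊕₁ f) ⨾ lu B ≈ lu A ⨾ f
  lu-natural = ι-jointly-epic (𝟘-initial _ _)
    (agree (ι₂⨾⊕ ▸ ≈-trans (pullʳ ι₂⨾[,]) identityʳ) (ι₂⨾[,] ▸ identityˡ))

  ru-isoˡ : ru A ⨾ ι₁ ≈ id
  ru-isoˡ = ι-jointly-epic (agree (ι₁⨾[,] ▸ identityˡ) identityʳ) (𝟘-initial _ _)

  ru-natural : {f : Hom A B} → (f ⊕₁ id {𝟘}) ⨾ ru B ≈ ru A ⨾ f
  ru-natural = ι-jointly-epic
    (agree (ι₁⨾⊕ ▸ ≈-trans (pullʳ ι₁⨾[,]) identityʳ) (ι₁⨾[,] ▸ identityˡ))
    (𝟘-initial _ _)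

  σ-natural : {f : Hom A A′} {g : Hom B B′} → (f ⊕₁ g) ⨾ σ A′ B′ ≈ σ A B ⨾ (g ⊕₁ f)
  σ-natural = ι-jointly-epic (agree (ι₁⨾⊕ ▸ pullʳ ι₁⨾[,]) (ι₁⨾[,] ▸ ι₂⨾⊕))
                             (agree (ι₂⨾⊕ ▸ pullʳ ι₂⨾[,]) (ι₂⨾[,] ▸ ι₁⨾⊕))

  σ-involutive : σ A B ⨾ σ B A ≈ id
  σ-involutive =
    ι-jointly-epic (agree (ι₁⨾[,] ▸ ι₂⨾[,]) identityʳ) (agree (ι₂⨾[,] ▸ ι₁⨾[,]) identityʳ)

  pentagon : (α A B C ⊕₁ id {D}) ⨾ α A (B ⊕₀ C) D ⨾ (id {A} ⊕₁ α B C D)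
             ≈ α (A ⊕₀ B) C D ⨾ α A B (C ⊕₀ D)
  pentagon = ι-jointly-epic₄
    (agree (ι₁⨾⊕′ ι₁ι₁⨾α ▸ ι₁ι₁⨾α ▸ ι₁⨾id⊕) (pullʳ₂ ι₁ι₁⨾α ▸ ι₁ι₁⨾α))
    (agree (ι₁⨾⊕′ ι₂ι₁⨾α ▸ ≈-trans (pullʳ₂ ι₂ι₁⨾α) sym-assoc ▸ ι₂⨾⊕′ ι₁ι₁⨾α)
           (pullʳ₂ ι₁ι₁⨾α ▸ ι₂ι₁⨾α))
    (agree (ι₁⨾⊕′ ι₂⨾α ▸ ≈-trans (pullʳ₂ ι₂ι₁⨾α) sym-assoc ▸ ι₂⨾⊕′ ι₂ι₁⨾α)
           (ι₂ι₁⨾α ▸ ≈-trans (pullʳ ι₂⨾α) sym-assoc))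
    (agree (ι₂⨾⊕id ▸ ι₂⨾α ▸ ι₂⨾⊕′ ι₂⨾α) (ι₂⨾α ▸ ≈-trans (pullʳ ι₂⨾α) sym-assoc))

  triangle : α A 𝟘 B ⨾ (id {A} ⊕₁ lu B) ≈ ru A ⊕₁ id {B}
  triangle = ι-jointly-epic₃
    (agree (ι₁ι₁⨾α ▸ ι₁⨾id⊕) (≈-trans (ι₁⨾⊕′ ι₁⨾[,]) identityˡ))
    (𝟘-initial _ _)
    (agree (ι₂⨾α ▸ ≈-trans (ι₂⨾⊕′ ι₂⨾[,]) identityˡ) ι₂⨾⊕id)

  hexagon : α A B C ⨾ σ A (B ⊕₀ C) ⨾ α B C A
            ≈ (σ A B ⊕₁ id {C}) ⨾ α B A C ⨾ (id {B} ⊕₁ σ A C)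
  hexagon = ι-jointly-epic₃
    (agree (ι₁ι₁⨾α ▸ ι₁⨾[,] ▸ ι₂⨾α) (ι₁⨾⊕′ ι₁⨾[,] ▸ ι₂ι₁⨾α ▸ ι₂⨾⊕′ ι₁⨾[,]))
    (agree (ι₂ι₁⨾α ▸ pullʳ ι₂⨾[,] ▸ ι₁ι₁⨾α) (ι₁⨾⊕′ ι₂⨾[,] ▸ ι₁ι₁⨾α ▸ ι₁⨾id⊕))
    (agree (ι₂⨾α ▸ pullʳ ι₂⨾[,] ▸ ι₂ι₁⨾α) (ι₂⨾⊕id ▸ ι₂⨾α ▸ ι₂⨾⊕′ ι₂⨾[,]))

  ∇-assoc : (∇ X ⊕₁ id {X}) ⨾ ∇ X ≈ α X X X ⨾ (id {X} ⊕₁ ∇ X) ⨾ ∇ X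
  ∇-assoc = ι-jointly-epic₃
    (agree (≈-trans (ι₁⨾⊕′ ι₁⨾[,]) identityˡ ▸ ι₁⨾[,]) (ι₁ι₁⨾α ▸ ι₁⨾id⊕ ▸ ι₁⨾[,]))
    (agree (≈-trans (ι₁⨾⊕′ ι₂⨾[,]) identityˡ ▸ ι₁⨾[,])
           (ι₂ι₁⨾α ▸ ≈-trans (ι₂⨾⊕′ ι₁⨾[,]) identityˡ ▸ ι₂⨾[,]))
    (agree (ι₂⨾⊕id ▸ ι₂⨾[,]) (ι₂⨾α ▸ ≈-trans (ι₂⨾⊕′ ι₂⨾[,]) identityˡ ▸ ι₂⨾[,]))

  ∇-unitˡ : (0# ⊕₁ id {X}) ⨾ ∇ X ≈ lu X
  ∇-unitˡ = ι-jointly-epic (𝟘-initial _ _) (agree (ι₂⨾⊕id ▸ ι₂⨾[,]) ι₂⨾[,])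

  ∇-unitʳ : (id {X} ⊕₁ 0#) ⨾ ∇ X ≈ ru X
  ∇-unitʳ = ι-jointly-epic (agree (ι₁⨾id⊕ ▸ ι₁⨾[,]) ι₁⨾[,]) (𝟘-initial _ _)

  ∇-comm : σ X X ⨾ ∇ X ≈ ∇ X
  ∇-comm = ι-jointly-epic (agree (ι₁⨾[,] ▸ ι₂⨾[,]) ι₁⨾[,]) (agree (ι₂⨾[,] ▸ ι₁⨾[,]) ι₂⨾[,])

  ∇-natural : {f : Hom X Y} → ∇ X ⨾ f ≈ (f ⊕₁ f) ⨾ ∇ Y
  ∇-natural = ι-jointly-epic
    (agree (ι₁⨾[,] ▸ identityˡ) (ι₁⨾⊕ ▸ ≈-trans (pullʳ ι₁⨾[,]) identityʳ))
    (agree (ι₂⨾[,] ▸ identityˡ) (ι₂⨾⊕ ▸ ≈-trans (pullʳ ι₂⨾[,]) identityʳ))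

  α⨾π₁ : α A B C ⨾ π₁ ≈ π₁ ⨾ π₁
  α⨾π₁ = ι-jointly-epic₃
    (agree (ι₁ι₁⨾α ▸ ι₁⨾π₁≈id) (⨾ι₁⨾π₁ ▸ ι₁⨾π₁≈id))
    (agree (ι₂ι₁⨾α ▸ ⨾ι₂⨾π₁) (⨾ι₁⨾π₁ ▸ ι₂⨾π₁≈0#))
    (agree (ι₂⨾α ▸ ⨾ι₂⨾π₁) ι₂⨾π₁⨾)

  α⨾π₂ : α A B C ⨾ π₂ ≈ π₂ ⊕₁ id {C}
  α⨾π₂ = ι-jointly-epic₃
    (agree (ι₁ι₁⨾α ▸ ι₁⨾π₂≈0#) (≈-trans (ι₁⨾⊕′ ι₁⨾π₂≈0#) ⨾-zeroˡ))
    (agree (ι₂ι₁⨾α ▸ ⨾ι₂⨾π₂) (≈-trans (ι₁⨾⊕′ ι₂⨾π₂≈id) identityˡ))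
    (agree (ι₂⨾α ▸ ⨾ι₂⨾π₂) ι₂⨾⊕id)

  Δ-assoc : Δ X ⨾ (Δ X ⊕₁ id {X}) ⨾ α X X X ≈ Δ X ⨾ (id {X} ⊕₁ Δ X)
  Δ-assoc = π-jointly-monic
    (agree (α⨾π₁ ◂ (⊕⨾π₁ ▸ ≈-trans (pullʳ ⟨,⟩⨾π₁) identityʳ) ◂ ⟨,⟩⨾π₁)
           (≈-trans ⊕⨾π₁ identityʳ ◂ ⟨,⟩⨾π₁))
    (agree (α⨾π₂ ◂ ≈-trans (≈-sym ⊕-⨾) (⊕-cong ⟨,⟩⨾π₂ identityˡ) ◂ ≈-trans (⨾-congʳ ⊕-id) identityʳ)
           (⊕⨾π₂ ◂ (⟨,⟩⨾π₂ ▸ identityˡ)))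

  Δ-unitˡ : Δ X ⨾ (0# ⊕₁ id {X}) ≈ ι₂
  Δ-unitˡ = π-jointly-monic (𝟘-terminal _ _) (agree (≈-trans ⊕⨾π₂ identityʳ ◂ ⟨,⟩⨾π₂) ι₂⨾π₂≈id)

  Δ-unitʳ : Δ X ⨾ (id {X} ⊕₁ 0#) ≈ ι₁
  Δ-unitʳ = π-jointly-monic (agree (≈-trans ⊕⨾π₁ identityʳ ◂ ⟨,⟩⨾π₁) ι₁⨾π₁≈id) (𝟘-terminal _ _)

  Δ-comm : Δ X ⨾ σ X X ≈ Δ X
  Δ-comm = ≈-trans ⟨,⟩⨾[,] +-comm

  Δ-natural : {f : Hom X Y} → f ⨾ Δ Y ≈ Δ X ⨾ (f ⊕₁ f)
  Δ-natural = π-jointly-monic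
    (agree (≈-trans (pullʳ ⟨,⟩⨾π₁) identityʳ) (⊕⨾π₁ ◂ (⟨,⟩⨾π₁ ▸ identityˡ)))
    (agree (≈-trans (pullʳ ⟨,⟩⨾π₂) identityʳ) (⊕⨾π₂ ◂ (⟨,⟩⨾π₂ ▸ identityˡ)))

  interchange : (X Y : Obj) → Hom ((X ⊕₀ Y) ⊕₀ (X ⊕₀ Y)) ((X ⊕₀ X) ⊕₀ (Y ⊕₀ Y))
  interchange X Y =
    α X Y (X ⊕₀ Y) ⨾ (id {X} ⊕₁ (α⁻¹ Y X Y ⨾ (σ Y X ⊕₁ id {Y}) ⨾ α X Y Y)) ⨾ α⁻¹ X X (Y ⊕₀ Y)

  interchange′ : (X Y : Obj) → Hom ((X ⊕₀ X) ⊕₀ (Y ⊕₀ Y)) ((X ⊕₀ Y) ⊕₀ (X ⊕₀ Y))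
  interchange′ X Y =
    α X X (Y ⊕₀ Y) ⨾ (id {X} ⊕₁ (α⁻¹ X Y Y ⨾ (σ X Y ⊕₁ id {Y}) ⨾ α Y X Y)) ⨾ α⁻¹ X Y (X ⊕₀ Y)

  ι₁ι₁⨾interchange : (ι₁ ⨾ ι₁) ⨾ interchange X Y ≈ ι₁ ⨾ ι₁
  ι₁ι₁⨾interchange = ι₁ι₁⨾α ▸ ι₁⨾id⊕ ▸ ι₁⨾α⁻¹

  ι₂ι₁⨾interchange : (ι₂ ⨾ ι₁) ⨾ interchange X Y ≈ ι₁ ⨾ ι₂
  ι₂ι₁⨾interchange = ι₂ι₁⨾α ▸ ι₂⨾⊕′ (ι₁⨾α⁻¹ ▸ ι₁⨾⊕′ ι₁⨾[,] ▸ ι₂ι₁⨾α) ▸ pullʳ₂ ι₂ι₂⨾α⁻¹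

  ι₁ι₂⨾interchange : (ι₁ ⨾ ι₂) ⨾ interchange X Y ≈ ι₂ ⨾ ι₁
  ι₁ι₂⨾interchange =
    ≈-trans (pullʳ ι₂⨾α) sym-assoc ▸ ι₂⨾⊕′ (ι₁ι₂⨾α⁻¹ ▸ ι₁⨾⊕′ ι₂⨾[,] ▸ ι₁ι₁⨾α) ▸ ι₁ι₂⨾α⁻¹

  ι₂ι₂⨾interchange : (ι₂ ⨾ ι₂) ⨾ interchange X Y ≈ ι₂ ⨾ ι₂
  ι₂ι₂⨾interchange =
    ≈-trans (pullʳ ι₂⨾α) sym-assoc ▸ ι₂⨾⊕′ (ι₂ι₂⨾α⁻¹ ▸ ι₂⨾⊕id ▸ ι₂⨾α) ▸ pullʳ₂ ι₂ι₂⨾α⁻¹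

  ∇-⊕ : ∇ (X ⊕₀ Y) ≈ interchange X Y ⨾ (∇ X ⊕₁ ∇ Y)
  ∇-⊕ = ι-jointly-epic₂₂
    (agree (≈-trans (pullʳ ι₁⨾[,]) identityʳ) (ι₁ι₁⨾interchange ▸ ≈-trans (ι₁⨾⊕′ ι₁⨾[,]) identityˡ))
    (agree (≈-trans (pullʳ ι₁⨾[,]) identityʳ) (ι₂ι₁⨾interchange ▸ ≈-trans (ι₂⨾⊕′ ι₁⨾[,]) identityˡ))
    (agree (≈-trans (pullʳ ι₂⨾[,]) identityʳ) (ι₁ι₂⨾interchange ▸ ≈-trans (ι₁⨾⊕′ ι₂⨾[,]) identityˡ))
    (agree (≈-trans (pullʳ ι₂⨾[,]) identityʳ) (ι₂ι₂⨾interchange ▸ ≈-trans (ι₂⨾⊕′ ι₂⨾[,]) identityˡ))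

  Δ-⊕ : Δ (X ⊕₀ Y) ≈ (Δ X ⊕₁ Δ Y) ⨾ interchange′ X Y
  Δ-⊕ = ι-jointly-epic
    (agree ⨾Δ (ι₁⨾⊕ ▸ ≈-trans (⨾-congˡ Δ⨾) (≈-trans ⨾-distribʳ (+-cong
      (ι₁ι₁⨾α ▸ ι₁⨾id⊕ ▸ ι₁⨾α⁻¹)
      (ι₂ι₁⨾α ▸ ι₂⨾⊕′ (ι₁⨾α⁻¹ ▸ ι₁⨾⊕′ ι₁⨾[,] ▸ ι₂ι₁⨾α) ▸ pullʳ₂ ι₂ι₂⨾α⁻¹)))))
    (agree ⨾Δ (ι₂⨾⊕ ▸ ≈-trans (⨾-congˡ Δ⨾) (≈-trans ⨾-distribʳ (+-cong
      (≈-trans (pullʳ ι₂⨾α) sym-assoc ▸ ι₂⨾⊕′ (ι₁ι₂⨾α⁻¹ ▸ ι₁⨾⊕′ ι₂⨾[,] ▸ ι₁ι₁⨾α) ▸ ι₁ι₂⨾α⁻¹)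
      (≈-trans (pullʳ ι₂⨾α) sym-assoc ▸ ι₂⨾⊕′ (ι₂ι₂⨾α⁻¹ ▸ ι₂⨾⊕id ▸ ι₂⨾α) ▸ pullʳ₂ ι₂ι₂⨾α⁻¹)))))
    where
    ⨾Δ : {x : Hom Z X} → x ⨾ Δ X ≈ x ⨾ ι₁ + x ⨾ ι₂
    ⨾Δ = ≈-trans ⨾-distribˡ (+-cong (⨾-congʳ identityˡ) (⨾-congʳ identityˡ))
    Δ⨾ : {y : Hom (X ⊕₀ X) Z} → Δ X ⨾ y ≈ ι₁ ⨾ y + ι₂ ⨾ y
    Δ⨾ = ≈-trans ⨾-distribʳ (+-cong (⨾-congˡ identityˡ) (⨾-congˡ identityˡ))

  ∇Δ-≥-id : id {X ⊕₀ X} ≤ ∇ X ⨾ Δ X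
  ∇Δ-≥-id = ≈-≤-trans (≈-trans [,]-η ([,]-cong identityʳ identityʳ))
    (≤-≈-trans ([,]-mono (≈-≤-trans (≈-sym identityˡ) f≤f+g) (≈-≤-trans (≈-sym identityˡ) g≤f+g))
               (≈-sym (≈-trans [,]-⨾ ([,]-cong identityˡ identityˡ))))

  Δ∇-≤-id : Δ X ⨾ ∇ X ≤ id
  Δ∇-≤-id = ≤-reflexive (≈-trans ⟨,⟩⨾[,] (≈-trans (+-cong identityˡ identityˡ) +-idem))

  infix 10 _*

  _* : Hom A A → Hom A A
  f * = star (stars _) f

  feedback : Hom S S → Hom X S → Hom S Y → Hom X Y → Hom X Y
  feedback a b c d = d + b ⨾ a * ⨾ c

  tr : (S X Y : Obj) → Hom (S ⊕₀ X) (S ⊕₀ Y) → Hom X Y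
  tr S X Y f = feedback ((ι₁ ⨾ f) ⨾ π₁) ((ι₂ ⨾ f) ⨾ π₁) ((ι₁ ⨾ f) ⨾ π₂) ((ι₂ ⨾ f) ⨾ π₂)

  feedback-mono : {a a′ : Hom S S} {b b′ : Hom X S} {c c′ : Hom S Y} {d d′ : Hom X Y} →
                  a ≤ a′ → b ≤ b′ → c ≤ c′ → d ≤ d′ → feedback a b c d ≤ feedback a′ b′ c′ d′
  feedback-mono a≤ b≤ c≤ d≤ = +-mono d≤ (⨾-mono b≤ (⨾-mono (*-mono (stars _) a≤) c≤))

  feedback-cong : {a a′ : Hom S S} {b b′ : Hom X S} {c c′ : Hom S Y} {d d′ : Hom X Y} →
                  a ≈ a′ → b ≈ b′ → c ≈ c′ → d ≈ d′ → feedback a b c d ≈ feedback a′ b′ c′ d′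
  feedback-cong a≈ b≈ c≈ d≈ = ≤-antisym
    (feedback-mono (≤-reflexive a≈) (≤-reflexive b≈) (≤-reflexive c≈) (≤-reflexive d≈))
    (feedback-mono (≤-reflexive (≈-sym a≈)) (≤-reflexive (≈-sym b≈)) (≤-reflexive (≈-sym c≈))
                   (≤-reflexive (≈-sym d≈)))

  entry-⨾ˡ : {u : Hom X Y} {P : Hom Y Z} {h : Hom Z W} {w : Hom W V} {p : Hom X U} {u′ : Hom U Z} →
             u ⨾ P ≈ p ⨾ u′ → (u ⨾ (P ⨾ h)) ⨾ w ≈ p ⨾ ((u′ ⨾ h) ⨾ w)
  entry-⨾ˡ uP≈pu′ = ≈-trans (⨾-congˡ (≈-trans sym-assoc (≈-trans (⨾-congˡ uP≈pu′) assoc))) assoc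

  entry-⨾ʳ : {u : Hom X Y} {h : Hom Y Z} {Q : Hom Z W} {w : Hom W V} {w′ : Hom Z U} {q : Hom U V} →
             Q ⨾ w ≈ w′ ⨾ q → (u ⨾ (h ⨾ Q)) ⨾ w ≈ ((u ⨾ h) ⨾ w′) ⨾ q
  entry-⨾ʳ Qw≈w′q = ≈-trans (⨾-congˡ sym-assoc) (≈-trans assoc (≈-trans (⨾-congʳ Qw≈w′q) sym-assoc))

  entry-feedback : {u : Hom U X} {w : Hom Y V} {a : Hom S S} {b : Hom X S} {c : Hom S Y}
                   {d : Hom X Y} →
                   (u ⨾ feedback a b c d) ⨾ w ≈ feedback a (u ⨾ b) (c ⨾ w) ((u ⨾ d) ⨾ w)
  entry-feedback = ≈-trans (⨾-congˡ ⨾-distribˡ) (≈-trans ⨾-distribʳ (+-congʳ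
    (≈-trans (⨾-congˡ sym-assoc) (≈-trans assoc (⨾-congʳ assoc)))))

  entry-conjugate : {u : Hom U A} {P : Hom A B} {h : Hom B C} {Q : Hom C D} {w : Hom D V}
                    {u′ : Hom U B} {w′ : Hom C V} →
                    u ⨾ P ≈ u′ → Q ⨾ w ≈ w′ → (u ⨾ (P ⨾ h ⨾ Q)) ⨾ w ≈ (u′ ⨾ h) ⨾ w′
  entry-conjugate uP≈u′ Qw≈w′ =
    ≈-trans (⨾-congˡ (≈-trans sym-assoc sym-assoc)) (≈-trans assoc (⨾-cong (⨾-congˡ uP≈u′) Qw≈w′))

  entry-assocˡ : {u : Hom U V} {v : Hom V A} {h : Hom A B} {w : Hom B C} →
                 u ⨾ ((v ⨾ h) ⨾ w) ≈ ((u ⨾ v) ⨾ h) ⨾ w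
  entry-assocˡ = ≈-trans sym-assoc (⨾-congˡ sym-assoc)

  entry-assoc : {u : Hom U V} {v : Hom V A} {h : Hom A B} {w : Hom B C} {z : Hom C D} →
                (u ⨾ ((v ⨾ h) ⨾ w)) ⨾ z ≈ ((u ⨾ v) ⨾ h) ⨾ (w ⨾ z)
  entry-assoc = ≈-trans (⨾-congˡ entry-assocˡ) assoc

  tightening : (f : Hom X′ X) (h : Hom (S ⊕₀ X) (S ⊕₀ Y)) (g : Hom Y Y′) →
               tr S X′ Y′ ((id {S} ⊕₁ f) ⨾ h ⨾ (id {S} ⊕₁ g)) ≈ f ⨾ tr S X Y h ⨾ g
  tightening f h g = ≈-trans
    (feedback-cong (≈-trans (entry-⨾ˡ ι₁⨾⊕) (≈-trans identityˡ (≈-trans (entry-⨾ʳ ⊕⨾π₁) identityʳ)))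
                   (≈-trans (entry-⨾ˡ ι₂⨾⊕) (⨾-congʳ (≈-trans (entry-⨾ʳ ⊕⨾π₁) identityʳ)))
                   (≈-trans (entry-⨾ˡ ι₁⨾⊕) (≈-trans identityˡ (entry-⨾ʳ ⊕⨾π₂)))
                   (≈-trans (entry-⨾ˡ ι₂⨾⊕) (≈-trans (⨾-congʳ (entry-⨾ʳ ⊕⨾π₂)) sym-assoc)))
    (≈-sym (≈-trans sym-assoc entry-feedback))

  sliding : (f : Hom (S ⊕₀ X) (T ⊕₀ Y)) (g : Hom T S) →
            tr S X Y (f ⨾ (g ⊕₁ id {Y})) ≈ tr T X Y ((g ⊕₁ id {X}) ⨾ f)
  sliding {S} {T = T} f g = ≈-trans
    (feedback-cong (entry-⨾ʳ ⊕⨾π₁) (entry-⨾ʳ ⊕⨾π₁)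
                   (≈-trans (entry-⨾ʳ ⊕⨾π₂) identityʳ) (≈-trans (entry-⨾ʳ ⊕⨾π₂) identityʳ))
    (≈-trans (+-congʳ (≈-trans assoc (⨾-congʳ (≈-trans sym-assoc
                (≈-trans (⨾-congˡ (*-sliding (stars S) (stars T))) assoc)))))
             (≈-sym (feedback-cong (entry-⨾ˡ ι₁⨾⊕) (≈-trans (entry-⨾ˡ ι₂⨾⊕) identityˡ)
                                   (entry-⨾ˡ ι₁⨾⊕) (≈-trans (entry-⨾ˡ ι₂⨾⊕) identityˡ))))

  yanking : tr X X X (σ X X) ≈ id
  yanking {X} = ≈-trans
    (feedback-cong (≈-trans (⨾-congˡ ι₁⨾[,]) ι₂⨾π₁≈0#) (≈-trans (⨾-congˡ ι₂⨾[,]) ι₁⨾π₁≈id)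
                   (≈-trans (⨾-congˡ ι₁⨾[,]) ι₂⨾π₂≈id) (≈-trans (⨾-congˡ ι₂⨾[,]) ι₁⨾π₂≈0#))
    (≈-trans +-identityˡ (≈-trans identityˡ (≈-trans identityʳ (0*≈id (stars X)))))

  vanishing : (f : Hom (𝟘 ⊕₀ X) (𝟘 ⊕₀ Y)) → tr 𝟘 X Y f ≈ ι₂ ⨾ f ⨾ lu Y
  vanishing f = ≈-trans (+-congʳ (≈-trans (⨾-congˡ (𝟘-terminal _ 0#)) ⨾-zeroˡ))
    (≈-trans +-identityʳ (≈-trans assoc (⨾-congʳ (⨾-congʳ (≈-sym lu≈π₂)))))
    where
    lu≈π₂ : lu Y ≈ π₂
    lu≈π₂ = ≈-trans (+-cong ⨾-zeroʳ identityʳ) +-identityˡ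

  AU1 : (f : Hom (S ⊕₀ X) (S ⊕₀ Y)) (g : Hom (T ⊕₀ X) (T ⊕₀ Y)) (r : Hom S T) →
        f ⨾ (r ⊕₁ id {Y}) ≤ (r ⊕₁ id {X}) ⨾ g → tr S X Y f ≤ tr T X Y g
  AU1 {S} {X} {Y} {T} f g r h = +-mono h₂₂
    (≤-trans (⨾-monoʳ (⨾-monoʳ h₁₂))
      (≈-≤-trans (⨾-congʳ sym-assoc)
        (≤-trans (⨾-monoʳ (⨾-monoˡ (*-simulationˡ (stars S) (stars T) h₁₁)))
          (≈-≤-trans (≈-trans (⨾-congʳ assoc) sym-assoc) (⨾-monoˡ h₂₁)))))
    where
    entries : ∀ {u : Hom U (S ⊕₀ X)} {w : Hom (T ⊕₀ Y) V} →
              (u ⨾ (f ⨾ (r ⊕₁ id))) ⨾ w ≤ (u ⨾ ((r ⊕₁ id) ⨾ g)) ⨾ w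
    entries = ⨾-monoˡ (⨾-monoʳ h)
    h₁₁ : ((ι₁ ⨾ f) ⨾ π₁) ⨾ r ≤ r ⨾ ((ι₁ ⨾ g) ⨾ π₁)
    h₁₁ = ≈-≤-trans (≈-sym (entry-⨾ʳ ⊕⨾π₁)) (≤-≈-trans entries (entry-⨾ˡ ι₁⨾⊕))
    h₂₁ : ((ι₂ ⨾ f) ⨾ π₁) ⨾ r ≤ (ι₂ ⨾ g) ⨾ π₁
    h₂₁ = ≈-≤-trans (≈-sym (entry-⨾ʳ ⊕⨾π₁)) (≤-≈-trans entries (≈-trans (entry-⨾ˡ ι₂⨾⊕) identityˡ))
    h₁₂ : (ι₁ ⨾ f) ⨾ π₂ ≤ r ⨾ ((ι₁ ⨾ g) ⨾ π₂)
    h₁₂ = ≈-≤-trans (≈-sym (≈-trans (entry-⨾ʳ ⊕⨾π₂) identityʳ)) (≤-≈-trans entries (entry-⨾ˡ ι₁⨾⊕))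
    h₂₂ : (ι₂ ⨾ f) ⨾ π₂ ≤ (ι₂ ⨾ g) ⨾ π₂
    h₂₂ = ≈-≤-trans (≈-sym (≈-trans (entry-⨾ʳ ⊕⨾π₂) identityʳ))
                    (≤-≈-trans entries (≈-trans (entry-⨾ˡ ι₂⨾⊕) identityˡ))

  AU2 : (f : Hom (S ⊕₀ X) (S ⊕₀ Y)) (g : Hom (T ⊕₀ X) (T ⊕₀ Y)) (r : Hom T S) →
        (r ⊕₁ id {X}) ⨾ f ≤ g ⨾ (r ⊕₁ id {Y}) → tr S X Y f ≤ tr T X Y g
  AU2 {S} {X} {Y} {T} f g r h = +-mono h₂₂
    (≤-trans (⨾-monoˡ h₂₁)
      (≈-≤-trans (≈-trans assoc (⨾-congʳ sym-assoc))
        (≤-trans (⨾-monoʳ (⨾-monoˡ (*-simulationʳ (stars T) (stars S) h₁₁)))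
          (≈-≤-trans (⨾-congʳ assoc) (⨾-monoʳ (⨾-monoʳ h₁₂))))))
    where
    entries : ∀ {u : Hom U (T ⊕₀ X)} {w : Hom (S ⊕₀ Y) V} →
              (u ⨾ ((r ⊕₁ id) ⨾ f)) ⨾ w ≤ (u ⨾ (g ⨾ (r ⊕₁ id))) ⨾ w
    entries = ⨾-monoˡ (⨾-monoʳ h)
    h₁₁ : r ⨾ ((ι₁ ⨾ f) ⨾ π₁) ≤ ((ι₁ ⨾ g) ⨾ π₁) ⨾ r
    h₁₁ = ≈-≤-trans (≈-sym (entry-⨾ˡ ι₁⨾⊕)) (≤-≈-trans entries (entry-⨾ʳ ⊕⨾π₁))
    h₂₁ : (ι₂ ⨾ f) ⨾ π₁ ≤ ((ι₂ ⨾ g) ⨾ π₁) ⨾ r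
    h₂₁ = ≈-≤-trans (≈-sym (≈-trans (entry-⨾ˡ ι₂⨾⊕) identityˡ)) (≤-≈-trans entries (entry-⨾ʳ ⊕⨾π₁))
    h₁₂ : r ⨾ ((ι₁ ⨾ f) ⨾ π₂) ≤ (ι₁ ⨾ g) ⨾ π₂
    h₁₂ = ≈-≤-trans (≈-sym (entry-⨾ˡ ι₁⨾⊕)) (≤-≈-trans entries (≈-trans (entry-⨾ʳ ⊕⨾π₂) identityʳ))
    h₂₂ : (ι₂ ⨾ f) ⨾ π₂ ≤ (ι₂ ⨾ g) ⨾ π₂
    h₂₂ = ≈-≤-trans (≈-sym (≈-trans (entry-⨾ˡ ι₂⨾⊕) identityˡ))
                    (≤-≈-trans entries (≈-trans (entry-⨾ʳ ⊕⨾π₂) identityʳ))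

  AT1 : tr X X X (∇ X ⨾ Δ X) ≤ id
  AT1 {X} = ≈-≤-trans
    (feedback-cong (entry ι₁⨾[,] ⟨,⟩⨾π₁) (entry ι₂⨾[,] ⟨,⟩⨾π₁)
                   (entry ι₁⨾[,] ⟨,⟩⨾π₂) (entry ι₂⨾[,] ⟨,⟩⨾π₂))
    (+-least ≤-refl (≈-≤-trans identityˡ (KleeneStar.*-inductionˡ (stars X) (≤-reflexive identityˡ))))
    where
    entry : ∀ {ι : Hom X (X ⊕₀ X)} {π : Hom (X ⊕₀ X) X} → ι ⨾ ∇ X ≈ id → Δ X ⨾ π ≈ id →
            (ι ⨾ (∇ X ⨾ Δ X)) ⨾ π ≈ id
    entry ι∇≈id Δπ≈id =
      ≈-trans (≈-trans (⨾-congˡ sym-assoc) assoc) (≈-trans (⨾-cong ι∇≈id Δπ≈id) identityˡ)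

  feedback-nesting :
    {x : Hom X Y} {b₁ : Hom X S} {b₂ : Hom X T} {c₁ : Hom S Y} {c₂ : Hom T Y}
    {a* : Hom S S} {p : Hom S T} {q : Hom T S} {s* : Hom T T} →
    x + (b₁ ⨾ ((a* + a* ⨾ p ⨾ s* ⨾ q ⨾ a*) ⨾ c₁ + (a* ⨾ p ⨾ s*) ⨾ c₂)
         + b₂ ⨾ ((s* ⨾ q ⨾ a*) ⨾ c₁ + s* ⨾ c₂))
      ≈ (x + b₁ ⨾ a* ⨾ c₁) + (b₂ + b₁ ⨾ a* ⨾ p) ⨾ s* ⨾ (c₂ + q ⨾ a* ⨾ c₁)
  feedback-nesting {X} {Y} {x = x} {b₁} {b₂} {c₁} {c₂} {a*} {p} {q} {s*} = begin
    x + (b₁ ⨾ ((a* + a* ⨾ p ⨾ s* ⨾ q ⨾ a*) ⨾ c₁ + (a* ⨾ p ⨾ s*) ⨾ c₂)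
         + b₂ ⨾ ((s* ⨾ q ⨾ a*) ⨾ c₁ + s* ⨾ c₂))
      ≈⟨ +-congʳ (+-cong (⨾-distribˡ′ (+-cong (≈-trans ⨾-distribʳ (+-congʳ assoc⁴)) assoc²))
                         (⨾-distribˡ′ (+-congˡ assoc²))) ⟩
    x + ((b₁ ⨾ (a* ⨾ c₁ + a* ⨾ p ⨾ s* ⨾ q ⨾ a* ⨾ c₁) + m₃) + (m₄ + m₅))
      ≈⟨ +-congʳ (+-congˡ (+-congˡ ⨾-distribˡ)) ⟩
    x + (((m₁ + m₂) + m₃) + (m₄ + m₅))
      ≈⟨ solve 6 (λ v₀ v₁ v₂ v₃ v₄ v₅ → v₀ ⊕ (((v₁ ⊕ v₂) ⊕ v₃) ⊕ (v₄ ⊕ v₅))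
                                        ⊜ (v₀ ⊕ v₁) ⊕ ((v₅ ⊕ v₄) ⊕ (v₃ ⊕ v₂)))
               ≈-refl x m₁ m₂ m₃ m₄ m₅ ⟩
    (x + m₁) + ((m₅ + m₄) + (m₃ + m₂))
      ≈⟨ +-congʳ (≈-trans ⨾-distribʳ (+-cong (⨾-distribˡ′ ⨾-distribˡ)
                   (≈-trans assoc² (⨾-distribˡ′ (⨾-distribˡ′ (⨾-distribˡ′ ⨾-distribˡ)))))) ⟨
    (x + b₁ ⨾ a* ⨾ c₁) + (b₂ + b₁ ⨾ a* ⨾ p) ⨾ s* ⨾ (c₂ + q ⨾ a* ⨾ c₁) ∎
    where
    open ≈-Reasoning
    open CommutativeMonoidSolver (+-commutativeMonoid X Y) using (solve; _⊜_; _⊕_)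
    m₁ m₂ m₃ m₄ m₅ : Hom X Y
    m₁ = b₁ ⨾ a* ⨾ c₁
    m₂ = b₁ ⨾ a* ⨾ p ⨾ s* ⨾ q ⨾ a* ⨾ c₁
    m₃ = b₁ ⨾ a* ⨾ p ⨾ s* ⨾ c₂
    m₄ = b₂ ⨾ s* ⨾ q ⨾ a* ⨾ c₁
    m₅ = b₂ ⨾ s* ⨾ c₂

  α⨾π₂⨾π₁ : α A B C ⨾ π₂ ⨾ π₁ ≈ π₁ ⨾ π₂
  α⨾π₂⨾π₁ = α⨾π₂ ▸ ⊕⨾π₁

  α⨾π₂⨾π₂ : α A B C ⨾ π₂ ⨾ π₂ ≈ π₂
  α⨾π₂⨾π₂ = α⨾π₂ ▸ ≈-trans ⊕⨾π₂ identityʳ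

  +⊕ : {x y : Hom A B} {g : Hom C D} → (x + y) ⊕₁ g ≈ x ⊕₁ g + π₁ ⨾ y ⨾ ι₁
  +⊕ = ι-jointly-epic
    (agree (≈-trans ι₁⨾⊕ ⨾-distribʳ) (≈-trans ⨾-distribˡ (+-cong ι₁⨾⊕ ι₁⨾π₁⨾)))
    (agree ι₂⨾⊕ (≈-trans ⨾-distribˡ (≈-trans (+-cong ι₂⨾⊕ ι₂⨾π₁⨾) +-identityʳ)))

  strength : (f : Hom (S ⊕₀ X) (S ⊕₀ Y)) (g : Hom Z W) →
             tr S (X ⊕₀ Z) (Y ⊕₀ W) (α⁻¹ S X Z ⨾ (f ⊕₁ g) ⨾ α S Y W) ≈ tr S X Y f ⊕₁ g
  strength {S} {X} {Y} {Z} {W} f g = ≈-trans (feedback-cong a≈ b≈ c≈ d≈)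
    (≈-trans (+-congʳ (≈-trans assoc (⨾-congʳ (≈-sym assoc²)))) (≈-sym +⊕))
    where
    h : Hom (S ⊕₀ (X ⊕₀ Z)) (S ⊕₀ (Y ⊕₀ W))
    h = α⁻¹ S X Z ⨾ (f ⊕₁ g) ⨾ α S Y W
    a≈ : (ι₁ ⨾ h) ⨾ π₁ ≈ (ι₁ ⨾ f) ⨾ π₁
    a≈ = ≈-trans (entry-conjugate ι₁⨾α⁻¹ α⨾π₁) (≈-trans (⨾-congˡ (ι₁⨾⊕′ ≈-refl)) (pullʳ ι₁⨾π₁⨾))
    b≈ : (ι₂ ⨾ h) ⨾ π₁ ≈ π₁ ⨾ (ι₂ ⨾ f) ⨾ π₁
    b≈ = ι-jointly-epic
      (agree (≈-trans entry-assocˡ (≈-trans (entry-conjugate ι₁ι₂⨾α⁻¹ α⨾π₁)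
               (≈-trans (⨾-congˡ (ι₁⨾⊕′ ≈-refl)) (pullʳ ι₁⨾π₁⨾)))) ι₁⨾π₁⨾)
      (agree (≈-trans entry-assocˡ (≈-trans (entry-conjugate ι₂ι₂⨾α⁻¹ α⨾π₁)
               (≈-trans (⨾-congˡ ι₂⨾⊕) (≈-trans (pullʳ ι₂⨾π₁⨾) ⨾-zeroʳ)))) ι₂⨾π₁⨾)
    c≈ : (ι₁ ⨾ h) ⨾ π₂ ≈ ((ι₁ ⨾ f) ⨾ π₂) ⨾ ι₁
    c≈ = ≈-trans (entry-conjugate ι₁⨾α⁻¹ α⨾π₂)
                 (≈-trans (⨾-congˡ (ι₁⨾⊕′ ≈-refl)) (≈-trans (pullʳ ι₁⨾⊕) sym-assoc))
    d≈ : (ι₂ ⨾ h) ⨾ π₂ ≈ ((ι₂ ⨾ f) ⨾ π₂) ⊕₁ g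
    d≈ = ι-jointly-epic
      (agree (≈-trans entry-assocˡ (≈-trans (entry-conjugate ι₁ι₂⨾α⁻¹ α⨾π₂)
               (≈-trans (⨾-congˡ (ι₁⨾⊕′ ≈-refl)) (≈-trans (pullʳ ι₁⨾⊕) sym-assoc)))) ι₁⨾⊕)
      (agree (≈-trans entry-assocˡ (≈-trans (entry-conjugate ι₂ι₂⨾α⁻¹ α⨾π₂)
               (≈-trans (⨾-congˡ ι₂⨾⊕) (pullʳ ι₂⨾⊕id)))) ι₂⨾⊕)

  module Joining {S T X Y : Obj} (f : Hom ((S ⊕₀ T) ⊕₀ X) ((S ⊕₀ T) ⊕₀ Y)) where
    open Conway (biproduct S T) (stars S) (stars T) using (conwayStar; module ConwayFormula)
    module C = ConwayFormula ((ι₁ ⨾ f) ⨾ π₁)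

    b : Hom X (S ⊕₀ T)
    b = (ι₂ ⨾ f) ⨾ π₁
    c : Hom (S ⊕₀ T) Y
    c = (ι₁ ⨾ f) ⨾ π₂
    d : Hom X Y
    d = (ι₂ ⨾ f) ⨾ π₂
    g : Hom (S ⊕₀ (T ⊕₀ X)) (S ⊕₀ (T ⊕₀ Y))
    g = α⁻¹ S T X ⨾ f ⨾ α S T Y

    trace-over-S⊕T :
      tr (S ⊕₀ T) X Y f
        ≈ d + ((b ⨾ π₁) ⨾ ((C.a* + C.a* ⨾ C.b ⨾ C.s* ⨾ C.c ⨾ C.a*) ⨾ ι₁ ⨾ c
                           + (C.a* ⨾ C.b ⨾ C.s*) ⨾ ι₂ ⨾ c)
               + (b ⨾ π₂) ⨾ ((C.s* ⨾ C.c ⨾ C.a*) ⨾ ι₁ ⨾ c + C.s* ⨾ ι₂ ⨾ c))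
    trace-over-S⊕T = +-congʳ (≈-trans (⨾-congʳ (⨾-congˡ (*-unique (stars (S ⊕₀ T)) conwayStar)))
                                      (BiproductProperties.⨾matrix⨾ (biproduct S T)))

    trace-over-S-then-T :
      tr T X Y (tr S (T ⊕₀ X) (T ⊕₀ Y) g)
        ≈ feedback (C.d + C.c ⨾ C.a* ⨾ C.b) (b ⨾ π₂ + (b ⨾ π₁) ⨾ C.a* ⨾ C.b)
                   (ι₂ ⨾ c + C.c ⨾ C.a* ⨾ ι₁ ⨾ c) (d + (b ⨾ π₁) ⨾ C.a* ⨾ ι₁ ⨾ c)
    trace-over-S-then-T = feedback-cong (entry a≈ c≈ b≈ d≈) (entry a≈ bπ₁≈ b≈ bπ₂≈)
                                        (entry a≈ c≈ ιc≈ ιc≈′) (entry a≈ bπ₁≈ ιc≈ d≈′)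
      where
      entry : ∀ {U V} {u : Hom U (T ⊕₀ X)} {w : Hom (T ⊕₀ Y) V} {b′ c′ d′} →
        (ι₁ ⨾ g) ⨾ π₁ ≈ C.a → u ⨾ (ι₂ ⨾ g) ⨾ π₁ ≈ b′ →
        ((ι₁ ⨾ g) ⨾ π₂) ⨾ w ≈ c′ → (u ⨾ (ι₂ ⨾ g) ⨾ π₂) ⨾ w ≈ d′ →
        (u ⨾ tr S (T ⊕₀ X) (T ⊕₀ Y) g) ⨾ w ≈ feedback C.a b′ c′ d′
      entry a≈ b≈ c≈ d≈ = ≈-trans entry-feedback (feedback-cong a≈ b≈ c≈ d≈)
      a≈ : (ι₁ ⨾ g) ⨾ π₁ ≈ C.a
      a≈ = ≈-trans (entry-conjugate ι₁⨾α⁻¹ α⨾π₁) (≈-sym entry-assoc)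
      c≈ : ι₁ ⨾ (ι₂ ⨾ g) ⨾ π₁ ≈ C.c
      c≈ = ≈-trans entry-assocˡ (≈-trans (entry-conjugate ι₁ι₂⨾α⁻¹ α⨾π₁) (≈-sym entry-assoc))
      bπ₁≈ : ι₂ ⨾ (ι₂ ⨾ g) ⨾ π₁ ≈ b ⨾ π₁
      bπ₁≈ = ≈-trans entry-assocˡ (≈-trans (entry-conjugate ι₂ι₂⨾α⁻¹ α⨾π₁) sym-assoc)
      b≈ : ((ι₁ ⨾ g) ⨾ π₂) ⨾ π₁ ≈ C.b
      b≈ = ≈-trans assoc (≈-trans (entry-conjugate ι₁⨾α⁻¹ α⨾π₂⨾π₁) (≈-sym entry-assoc))
      ιc≈ : ((ι₁ ⨾ g) ⨾ π₂) ⨾ π₂ ≈ ι₁ ⨾ c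
      ιc≈ = ≈-trans assoc (≈-trans (entry-conjugate ι₁⨾α⁻¹ α⨾π₂⨾π₂) (≈-sym entry-assocˡ))
      d≈ : (ι₁ ⨾ (ι₂ ⨾ g) ⨾ π₂) ⨾ π₁ ≈ C.d
      d≈ = ≈-trans entry-assoc (≈-trans (entry-conjugate ι₁ι₂⨾α⁻¹ α⨾π₂⨾π₁) (≈-sym entry-assoc))
      bπ₂≈ : (ι₂ ⨾ (ι₂ ⨾ g) ⨾ π₂) ⨾ π₁ ≈ b ⨾ π₂
      bπ₂≈ = ≈-trans entry-assoc (≈-trans (entry-conjugate ι₂ι₂⨾α⁻¹ α⨾π₂⨾π₁) sym-assoc)
      ιc≈′ : (ι₁ ⨾ (ι₂ ⨾ g) ⨾ π₂) ⨾ π₂ ≈ ι₂ ⨾ c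
      ιc≈′ = ≈-trans entry-assoc (≈-trans (entry-conjugate ι₁ι₂⨾α⁻¹ α⨾π₂⨾π₂) (≈-sym entry-assocˡ))
      d≈′ : (ι₂ ⨾ (ι₂ ⨾ g) ⨾ π₂) ⨾ π₂ ≈ d
      d≈′ = ≈-trans entry-assoc (entry-conjugate ι₂ι₂⨾α⁻¹ α⨾π₂⨾π₂)

  joining : (f : Hom ((S ⊕₀ T) ⊕₀ X) ((S ⊕₀ T) ⊕₀ Y)) →
            tr (S ⊕₀ T) X Y f ≈ tr T X Y (tr S (T ⊕₀ X) (T ⊕₀ Y) (α⁻¹ S T X ⨾ f ⨾ α S T Y))
  joining f = ≈-trans trace-over-S⊕T (≈-trans feedback-nesting (≈-sym trace-over-S-then-T))
    where open Joining f

  tensorData : PosetTensorData o ℓ e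
  tensorData = record
    { Obj = Obj ; Hom = Hom ; _≈_ = _≈_ ; _≤_ = _≤_ ; id = λ A → id {A} ; _⨾_ = _⨾_
    ; _⊕₀_ = _⊕₀_ ; _⊕₁_ = _⊕₁_ ; 𝟘 = 𝟘 }

  isKleeneBicategory : IsKleeneBicategory tensorData
  isKleeneBicategory = record
    { ≈-refl = ≈-refl ; ≈-sym = ≈-sym ; ≈-trans = ≈-trans
    ; ≤-reflexive = ≤-reflexive ; ≤-trans = ≤-trans ; ≤-antisym = ≤-antisym
    ; ⨾-mono = ⨾-mono ; identityˡ = identityˡ ; identityʳ = identityʳ ; assoc = assoc
    ; ⊕-mono = ⊕-mono ; ⊕-id = ⊕-id ; ⊕-⨾ = ⊕-⨾
    ; α = α ; α⁻¹ = α⁻¹ ; α-isoˡ = α-isoˡ ; α-isoʳ = α-isoʳ ; α-natural = α-natural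
    ; lu = lu ; lu⁻¹ = λ _ → ι₂ ; lu-isoˡ = lu-isoˡ ; lu-isoʳ = ι₂⨾[,] ; lu-natural = lu-natural
    ; ru = ru ; ru⁻¹ = λ _ → ι₁ ; ru-isoˡ = ru-isoˡ ; ru-isoʳ = ι₁⨾[,] ; ru-natural = ru-natural
    ; σ = σ ; σ-natural = σ-natural ; σ-involutive = σ-involutive
    ; pentagon = pentagon ; triangle = triangle ; hexagon = hexagon
    ; ∇ = ∇ ; ¡ = λ _ → 0# ; Δ = Δ ; ! = λ _ → 0#
    ; ∇-assoc = ∇-assoc ; ∇-unitˡ = ∇-unitˡ ; ∇-unitʳ = ∇-unitʳ ; ∇-comm = ∇-comm
    ; Δ-assoc = Δ-assoc ; Δ-unitˡ = Δ-unitˡ ; Δ-unitʳ = Δ-unitʳ ; Δ-comm = Δ-comm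
    ; ∇-natural = ∇-natural ; ¡-natural = ⨾-zeroˡ ; Δ-natural = Δ-natural ; !-natural = ⨾-zeroʳ
    ; ∇-⊕ = ∇-⊕ ; ¡-⊕ = 𝟘-initial _ _ ; Δ-⊕ = Δ-⊕ ; !-⊕ = 𝟘-terminal _ _
    ; ∇-𝟘 = 𝟘-terminal _ _ ; ¡-𝟘 = 𝟘-initial _ _ ; Δ-𝟘 = 𝟘-initial _ _ ; !-𝟘 = 𝟘-terminal _ _
    ; ∇Δ-≥-id = ∇Δ-≥-id ; Δ∇-≤-id = Δ∇-≤-id
    ; ¡!-≥-id = ≤-reflexive (𝟘-initial _ _) ; !¡-≤-id = ≈-≤-trans ⨾-zeroˡ 0#≤
    ; tr = tr ; tightening = tightening ; strength = strength ; joining = joining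
    ; vanishing = vanishing ; sliding = sliding ; yanking = yanking
    ; AU1 = AU1 ; AU2 = AU2 ; AT1 = AT1
    }

proposition6p9 : ∀ {o ℓ e} (K : TypedKleeneAlgebra o ℓ e) → IsKleeneBicategory (Mat K)
proposition6p9 K = BiproductKleeneBicategory.isKleeneBicategory matBiproducts matStar
  where open Matrices K
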